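{- Let $d\ge 2$, let $p_1,\dots,p_d$ be pairwise distinct primes, $k_1,\dots,k_d$ positive integers, and $k=p_1^{k_1}\cdots p_d^{k_d}$. For each $i$ let $M_i\in D(p_i^{k_i},p_i^{k_i},\mathbb{Z}_{p_i}^{k_i})$ and let $(a^i(n))_{n\ge0}$ be the Rudin--Shapiro sequence associated to $M_i$. Put $\hat a(n)=(a^1(n),\dots,a^d(n))$ and for $0\le i<j$ let $\delta(i,j)=0$ if $\hat a(i)=\hat a(j)$ and $1$ otherwise. Let $0\le r_1<r_2$ (possibly depending on $N$). If $r_2=o(N^{1/d})$, then $$\sum_{n<N}\delta(n+r_1,n+r_2)\sim N\left(1-\frac1k\right)\quad (N\to\infty).$$
   Context: $\mathbb{Z}_p=\mathbb{Z}/p\mathbb{Z}$. For a finite abelian group $G$, a difference matrix of size $r\times c$ over $G$ is a matrix $(d_{ij})$ such that for all distinct columns $i\neq j$ the multiset $\{d_{li}-d_{lj}:1\le l\le r\}$ contains every element of $G$ equally often; $D(r,c,G)$ is the set of these. Given a prime $p$, $m\ge1$ and $M=(m_{ij})_{0\le i,j<p^m}\in D(p^m,p^m,\mathbb{Z}_p^m)$, set $g(j,n)=m_{n \bmod p^m,\, j\bmod p^m}$; the Rudin--Shapiro sequence associated to $M$ is the $\mathbb{Z}_p^m$-valued sequence with $a(0)$ arbitrary and $a(p^mn+j)=a(n)+g(j,n)$ for $0\le j\le p^m-1$, $n\ge0$, $(j,n)\ne(0,0)$. -}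

module Defs where

open import Data.Nat using (ℕ; zero; suc; _+_; _*_; _∸_; _^_; _≤_; _<_; NonZero)
open import Data.Nat.Properties using (m^n≢0)
open import Data.Nat.DivMod using (_mod_)
open import Data.Nat.Primality using (Prime; prime⇒nonZero)
open import Data.Fin using (Fin; toℕ)
import Data.Fin as Fin
open import Data.Fin.Properties using (all?)
open import Data.Vec using (Vec; zipWith)
import Data.Vec.Properties as VecP
open import Data.Sum using (_⊎_)
open import Data.Product using (Σ; _×_)
open import Relation.Binary.PropositionalEquality using (_≡_; _≢_)
open import Relation.Nullary using (¬_; Dec; yes; no)
open import Relation.Nullary.Decidable using (¬?)
open import Data.Integer using (ℤ; +_; ∣_∣) renaming (_-_ to _-ℤ_)

addZ : (p : ℕ) .{{_ : NonZero p}} → Fin p → Fin p → Fin p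
addZ p a b = (toℕ a + toℕ b) mod p

subZ : (p : ℕ) .{{_ : NonZero p}} → Fin p → Fin p → Fin p
subZ p a b = (toℕ a + (p ∸ toℕ b)) mod p

ZV : ℕ → ℕ → Set
ZV p m = Vec (Fin p) m

addV : (p : ℕ) .{{_ : NonZero p}} {m : ℕ} → ZV p m → ZV p m → ZV p m
addV p = zipWith (addZ p)

subV : (p : ℕ) .{{_ : NonZero p}} {m : ℕ} → ZV p m → ZV p m → ZV p m
subV p = zipWith (subZ p)

_≟V_ : {p m : ℕ} → (x y : ZV p m) → Dec (x ≡ y)
_≟V_ = VecP.≡-dec Fin._≟_

countFin : (r : ℕ) → (P : Fin r → Set) → ((l : Fin r) → Dec (P l)) → ℕ
countFin zero P P? = 0
countFin (suc r) P P? with P? Fin.zero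
... | yes _ = suc (countFin r (λ l → P (Fin.suc l)) (λ l → P? (Fin.suc l)))
... | no _ = countFin r (λ l → P (Fin.suc l)) (λ l → P? (Fin.suc l))

countBelow : (N : ℕ) → (P : ℕ → Set) → ((n : ℕ) → Dec (P n)) → ℕ
countBelow zero P P? = 0
countBelow (suc N) P P? with P? N
... | yes _ = suc (countBelow N P P?)
... | no _ = countBelow N P P?

prodFin : (d : ℕ) → (Fin d → ℕ) → ℕ
prodFin zero f = 1
prodFin (suc d) f = f Fin.zero * prodFin d (λ i → f (Fin.suc i))

-- Difference matrices D(r,c,ℤ_p^m); entries D l i with l the row, i the column.
-- For distinct columns i ≠ j, each g ∈ ℤ_p^m occurs equally often among
-- the differences D l i - D l j (1 ≤ l ≤ r).
IsDiffMatrix : (p m r c : ℕ) → Prime p → (Fin r → Fin c → ZV p m) → Set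
IsDiffMatrix p m r c pp D =
  (i j : Fin c) → i ≢ j → (g h : ZV p m) →
    countFin r (λ l → subV p (D l i) (D l j) ≡ g) (λ l → subV p (D l i) (D l j) ≟V g)
    ≡ countFin r (λ l → subV p (D l i) (D l j) ≡ h) (λ l → subV p (D l i) (D l j) ≟V h)
  where instance _ = prime⇒nonZero pp

-- a is the Rudin–Shapiro sequence associated to M ∈ D(p^m,p^m,ℤ_p^m)
-- (with arbitrary a(0)):  a(p^m n + j) = a(n) + g(j,n) for 0 ≤ j < p^m,
-- (j,n) ≠ (0,0), where g(j,n) = M_{n mod p^m, j mod p^m} (here j mod p^m = j).
IsRudinShapiro : (p m : ℕ) → (pp : Prime p) →
  (Fin (p ^ m) → Fin (p ^ m) → ZV p m) → (ℕ → ZV p m) → Set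
IsRudinShapiro p m pp M a =
  (n : ℕ) (j : Fin (p ^ m)) → (toℕ j ≢ 0 ⊎ n ≢ 0) →
    a (p ^ m * n + toℕ j) ≡ addV p (a n) (M (n mod (p ^ m)) j)
  where
  instance
    _ = prime⇒nonZero pp
    _ = m^n≢0 p m {{prime⇒nonZero pp}}

deltaSum : (d : ℕ) → (p k : Fin d → ℕ) → (a : (i : Fin d) → ℕ → ZV (p i) (k i)) →
  (r₁ r₂ N : ℕ) → ℕ
deltaSum d p k a r₁ r₂ N =
  countBelow N (λ n → ¬ ((i : Fin d) → a i (n + r₁) ≡ a i (n + r₂)))
    (λ n → ¬? (all? (λ i → a i (n + r₁) ≟V a i (n + r₂))))

-- r = o(N^{1/d}), written without reals: for every e, eventually
-- (e+1) · r(N)^d ≤ N  (equivalent to r(N) ≤ ε N^{1/d} eventually for all ε > 0).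
LittleORoot : (d : ℕ) → (ℕ → ℕ) → Set
LittleORoot d r = (e : ℕ) → Σ ℕ λ N₀ → (N : ℕ) → N₀ ≤ N → suc e * r N ^ d ≤ N

-- S(N) ~ N(1 - 1/k) as N → ∞, i.e. |S(N)/(N(1-1/k)) - 1| → 0; multiplied
-- through by k: for all e, eventually (e+1)·|k S(N) - N(k-1)| ≤ N(k-1).
AsympEquivOneMinusInv : (k : ℕ) → (ℕ → ℕ) → Set
AsympEquivOneMinusInv k S = (e : ℕ) → Σ ℕ λ N₀ → (N : ℕ) → N₀ ≤ N →
  suc e * ∣ (+ (k * S N)) -ℤ (+ (N * (k ∸ 1))) ∣ ≤ N * (k ∸ 1)

{-# OPTIONS --safe #-}
module Submission where

-- Write h = r₂ - r₁ and q = p^m for one of the sequences. Unfolding the recursion L times gives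
-- a(q^L T + s) = a(T) + Δ_L(s, T) (increment below), where Δ_L(s, T) depends on T only modulo q.
-- So whenever s and s + h lie in the same block of length R = q^L, whether a(y) = a(y + h) is
-- decided by a function of y that is periodic with period q R, and the difference-matrix property
-- (every difference occurs in exactly one row) shows that it holds for exactly a fraction 1/q of
-- such positions in each period. The periods of the d sequences are powers of distinct primes, so
-- by the Chinese remainder theorem the joint event has density 1/k over the product period Q.
-- Choosing R ≈ U h for a large U keeps the straddling positions (s + h ≥ R) a fraction at most
-- d/U, and r₂ = o(N^{1/d}) makes Q = O(r₂^d) small compared with N, so counting over consecutive
-- windows of length Q gives N/k + o(N) coincidences among n < N.

open import Defs
open import Data.Nat
open import Data.Nat.Properties
open import Data.Nat.DivMod
open import Data.Nat.Divisibility using (_∣_; divides; m∣m*n; n∣m*n; ∣⇒≤; ∣-trans; 1∣_; ∣1⇒≡1; *-monoʳ-∣; *-cancelˡ-∣)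
open import Data.Nat.Primality using (Prime; prime⇒nonZero; prime⇒nonTrivial; prime⇒irreducible; euclidsLemma)
open import Data.Nat.Solver using (module +-*-Solver)
open import Data.Fin as Fin using (Fin; toℕ)
import Data.Fin.Properties as Fin
open import Data.Vec using ([]; _∷_; replicate; head; tail)
open import Data.Integer as ℤ using (∣_∣; _⊖_) renaming (+_ to ⁺_)
import Data.Integer.Properties as ℤ
open import Data.Product using (Σ; _×_; _,_; proj₁; proj₂)
open import Data.Sum using (_⊎_; inj₁; inj₂)
open import Data.Empty using (⊥-elim)
open import Function using (_∘_)
open import Relation.Binary.PropositionalEquality
open import Relation.Nullary using (Dec; yes; no; ¬_)
open import Relation.Nullary.Decidable using (_×-dec_; ¬?)
open import Algebra.Properties.Semiring.Sum +-*-semiring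
  using (sum; sum-syntax; ∑-comm; *-distribˡ-sum; sum-cong-≗)

open +-*-Solver

𝟙 : {P : Set} → Dec P → ℕ
𝟙 (yes _) = 1
𝟙 (no _) = 0

𝟙≤1 : ∀ {P : Set} (P? : Dec P) → 𝟙 P? ≤ 1
𝟙≤1 (yes _) = ≤-refl
𝟙≤1 (no _) = z≤n

𝟙-yes : ∀ {P : Set} (P? : Dec P) → P → 𝟙 P? ≡ 1
𝟙-yes (yes _) _ = refl
𝟙-yes (no ¬x) x = ⊥-elim (¬x x)

𝟙-no : ∀ {P : Set} (P? : Dec P) → ¬ P → 𝟙 P? ≡ 0
𝟙-no (yes x) ¬x = ⊥-elim (¬x x)
𝟙-no (no _) _ = refl

𝟙≡1⇒ : ∀ {P : Set} (P? : Dec P) → 𝟙 P? ≡ 1 → P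
𝟙≡1⇒ (yes x) _ = x

𝟙-¬+𝟙 : ∀ {P : Set} (P? : Dec P) → 𝟙 (¬? P?) + 𝟙 P? ≡ 1
𝟙-¬+𝟙 (yes _) = refl
𝟙-¬+𝟙 (no _) = refl

𝟙-cong : ∀ {P Q : Set} (P? : Dec P) (Q? : Dec Q) → (P → Q) → (Q → P) → 𝟙 P? ≡ 𝟙 Q?
𝟙-cong (yes _) (yes _) _ _ = refl
𝟙-cong (no _) (no _) _ _ = refl
𝟙-cong (yes x) (no ¬y) f _ = ⊥-elim (¬y (f x))
𝟙-cong (no ¬x) (yes y) _ g = ⊥-elim (¬x (g y))

𝟙-mono : ∀ {P Q : Set} (P? : Dec P) (Q? : Dec Q) → (P → Q) → 𝟙 P? ≤ 𝟙 Q?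
𝟙-mono (yes x) Q? f = ≤-reflexive (sym (𝟙-yes Q? (f x)))
𝟙-mono (no _) Q? f = z≤n

sumℕ : ℕ → (ℕ → ℕ) → ℕ
sumℕ zero f = 0
sumℕ (suc n) f = sumℕ n f + f n

syntax sumℕ n (λ x → e) = ∑ℕ[ x < n ] e

countBelow≡∑𝟙 : ∀ N (P : ℕ → Set) (P? : ∀ n → Dec (P n)) → countBelow N P P? ≡ ∑ℕ[ n < N ] 𝟙 (P? n)
countBelow≡∑𝟙 zero P P? = refl
countBelow≡∑𝟙 (suc N) P P? with P? N
... | yes _ = trans (cong suc (countBelow≡∑𝟙 N P P?)) (+-comm 1 _)
... | no _ = trans (countBelow≡∑𝟙 N P P?) (sym (+-identityʳ _))

sumℕ-cong : ∀ n {f g : ℕ → ℕ} → (∀ x → x < n → f x ≡ g x) → sumℕ n f ≡ sumℕ n g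
sumℕ-cong zero eq = refl
sumℕ-cong (suc n) eq = cong₂ _+_ (sumℕ-cong n (λ x x<n → eq x (m<n⇒m<1+n x<n))) (eq n ≤-refl)

sumℕ-mono : ∀ n {f g : ℕ → ℕ} → (∀ x → x < n → f x ≤ g x) → sumℕ n f ≤ sumℕ n g
sumℕ-mono zero le = z≤n
sumℕ-mono (suc n) le = +-mono-≤ (sumℕ-mono n (λ x x<n → le x (m<n⇒m<1+n x<n))) (le n ≤-refl)

sumℕ-distrib-+ : ∀ n (f g : ℕ → ℕ) → ∑ℕ[ x < n ] (f x + g x) ≡ sumℕ n f + sumℕ n g
sumℕ-distrib-+ zero f g = refl
sumℕ-distrib-+ (suc n) f g = begin
  sumℕ n (λ x → f x + g x) + (f n + g n) ≡⟨ cong (_+ (f n + g n)) (sumℕ-distrib-+ n f g) ⟩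
  sumℕ n f + sumℕ n g + (f n + g n)      ≡⟨ solve 4 (λ a b c d → a :+ b :+ (c :+ d) := a :+ c :+ (b :+ d))
                                                  refl (sumℕ n f) (sumℕ n g) (f n) (g n) ⟩
  sumℕ n f + f n + (sumℕ n g + g n)      ∎
  where open ≡-Reasoning

*-distribˡ-sumℕ : ∀ c n (f : ℕ → ℕ) → c * sumℕ n f ≡ ∑ℕ[ x < n ] (c * f x)
*-distribˡ-sumℕ c zero f = *-zeroʳ c
*-distribˡ-sumℕ c (suc n) f =
  trans (*-distribˡ-+ c (sumℕ n f) (f n)) (cong (_+ c * f n) (*-distribˡ-sumℕ c n f))

sumℕ-const : ∀ n c → ∑ℕ[ x < n ] c ≡ n * c
sumℕ-const zero c = refl
sumℕ-const (suc n) c = trans (cong (_+ c) (sumℕ-const n c)) (+-comm (n * c) c)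

sumℕ-zero : ∀ n {f : ℕ → ℕ} → (∀ x → x < n → f x ≡ 0) → sumℕ n f ≡ 0
sumℕ-zero n {f} eq = trans (sumℕ-cong n eq) (trans (sumℕ-const n 0) (*-zeroʳ n))

sumℕ-≤ : ∀ n c {f : ℕ → ℕ} → (∀ x → x < n → f x ≤ c) → sumℕ n f ≤ n * c
sumℕ-≤ n c le = ≤-trans (sumℕ-mono n le) (≤-reflexive (sumℕ-const n c))

sumℕ-+ : ∀ m n (f : ℕ → ℕ) → sumℕ (m + n) f ≡ sumℕ m f + ∑ℕ[ x < n ] f (m + x)
sumℕ-+ m zero f = trans (cong (λ k → sumℕ k f) (+-identityʳ m)) (sym (+-identityʳ _))
sumℕ-+ m (suc n) f = begin
  sumℕ (m + suc n) f                                    ≡⟨ cong (λ k → sumℕ k f) (+-suc m n) ⟩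
  sumℕ (m + n) f + f (m + n)                            ≡⟨ cong (_+ f (m + n)) (sumℕ-+ m n f) ⟩
  sumℕ m f + ∑ℕ[ x < n ] f (m + x) + f (m + n)          ≡⟨ +-assoc (sumℕ m f) _ _ ⟩
  sumℕ m f + (∑ℕ[ x < n ] f (m + x) + f (m + n))        ∎
  where open ≡-Reasoning

sumℕ-* : ∀ a b (f : ℕ → ℕ) → sumℕ (a * b) f ≡ ∑ℕ[ x < a ] ∑ℕ[ y < b ] f (b * x + y)
sumℕ-* zero b f = refl
sumℕ-* (suc a) b f = begin
  sumℕ (b + a * b) f                                     ≡⟨ cong (λ k → sumℕ k f) (+-comm b (a * b)) ⟩
  sumℕ (a * b + b) f                                     ≡⟨ sumℕ-+ (a * b) b f ⟩
  sumℕ (a * b) f + ∑ℕ[ y < b ] f (a * b + y)             ≡⟨ cong₂ _+_ (sumℕ-* a b f)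
                                                              (sumℕ-cong b (λ y _ → cong (λ z → f (z + y)) (*-comm a b))) ⟩
  ∑ℕ[ x < a ] ∑ℕ[ y < b ] f (b * x + y) + ∑ℕ[ y < b ] f (b * a + y) ∎
  where open ≡-Reasoning

sumℕ-comm : ∀ m n (f : ℕ → ℕ → ℕ) → ∑ℕ[ x < m ] sumℕ n (f x) ≡ ∑ℕ[ y < n ] ∑ℕ[ x < m ] f x y
sumℕ-comm zero n f = sym (sumℕ-zero n (λ _ _ → refl))
sumℕ-comm (suc m) n f = begin
  ∑ℕ[ x < m ] sumℕ n (f x) + sumℕ n (f m)          ≡⟨ cong (_+ sumℕ n (f m)) (sumℕ-comm m n f) ⟩
  ∑ℕ[ y < n ] ∑ℕ[ x < m ] f x y + sumℕ n (f m)     ≡⟨ sym (sumℕ-distrib-+ n _ (f m)) ⟩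
  ∑ℕ[ y < n ] (∑ℕ[ x < m ] f x y + f m y)          ∎
  where open ≡-Reasoning

sumℕ-single : ∀ n x₀ {f : ℕ → ℕ} → x₀ < n → (∀ x → x < n → x ≢ x₀ → f x ≡ 0) → sumℕ n f ≡ f x₀
sumℕ-single (suc n) x₀ {f} x₀<1+n vanish with m≤n⇒m<n∨m≡n (s≤s⁻¹ x₀<1+n)
... | inj₁ x₀<n = trans (cong₂ _+_ (sumℕ-single n x₀ x₀<n (λ x x<n → vanish x (m<n⇒m<1+n x<n)))
                                    (vanish n ≤-refl (λ n≡x₀ → <-irrefl (sym n≡x₀) x₀<n)))
                         (+-identityʳ (f x₀))
... | inj₂ refl = cong (_+ f x₀) (sumℕ-zero x₀ (λ x x<n → vanish x (m<n⇒m<1+n x<n) (<⇒≢ x<n)))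

sumℕ-≤1 : ∀ n {f : ℕ → ℕ} → (∀ x → x < n → f x ≤ 1) →
  (∀ x y → x < n → y < n → f x ≡ 1 → f y ≡ 1 → x ≡ y) → sumℕ n f ≤ 1
sumℕ-≤1 zero _ _ = z≤n
sumℕ-≤1 (suc n) {f} ≤1 unique with f n in eq | ≤1 n ≤-refl
... | zero | _ = ≤-trans (≤-reflexive (+-identityʳ _))
                    (sumℕ-≤1 n (λ x x<n → ≤1 x (m<n⇒m<1+n x<n))
                       (λ x y x<n y<n → unique x y (m<n⇒m<1+n x<n) (m<n⇒m<1+n y<n)))
... | suc (suc _) | s≤s ()
... | suc zero | _ = ≤-reflexive (cong (_+ 1) (sumℕ-zero n vanish))
  where
  vanish : ∀ x → x < n → f x ≡ 0
  vanish x x<n with f x in fx | ≤1 x (m<n⇒m<1+n x<n)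
  ... | zero | _ = refl
  ... | suc zero | _ = ⊥-elim (<⇒≢ x<n (unique x n (m<n⇒m<1+n x<n) ≤-refl fx eq))
  ... | suc (suc _) | s≤s ()

sumℕ≡n⇒all≡1 : ∀ n {f : ℕ → ℕ} → (∀ x → x < n → f x ≤ 1) → sumℕ n f ≡ n → ∀ x → x < n → f x ≡ 1
sumℕ≡n⇒all≡1 (suc n) {f} ≤1 total x x<1+n = case (m≤n⇒m<n∨m≡n (s≤s⁻¹ x<1+n))
  where
  ≤1′ : ∀ x → x < n → f x ≤ 1
  ≤1′ x x<n = ≤1 x (m<n⇒m<1+n x<n)
  head≤n : sumℕ n f ≤ n
  head≤n = ≤-trans (sumℕ-≤ n 1 ≤1′) (≤-reflexive (*-identityʳ n))
  last≡1 : f n ≡ 1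
  last≡1 = ≤-antisym (≤1 n ≤-refl) (+-cancelˡ-≤ n 1 (f n) (begin
    n + 1          ≡⟨ +-comm n 1 ⟩
    suc n          ≡⟨ sym total ⟩
    sumℕ n f + f n ≤⟨ +-monoˡ-≤ (f n) head≤n ⟩
    n + f n        ∎))
    where open ≤-Reasoning
  head≡n : sumℕ n f ≡ n
  head≡n = +-cancelʳ-≡ 1 _ _ (trans (cong (sumℕ n f +_) (sym last≡1)) (trans total (+-comm 1 n)))
  case : x < n ⊎ x ≡ n → f x ≡ 1
  case (inj₁ x<n) = sumℕ≡n⇒all≡1 n ≤1′ head≡n x x<n
  case (inj₂ refl) = last≡1

∑-mono : ∀ n {f g : Fin n → ℕ} → (∀ i → f i ≤ g i) → sum f ≤ sum g
∑-mono zero le = z≤n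
∑-mono (suc n) le = +-mono-≤ (le Fin.zero) (∑-mono n (le ∘ Fin.suc))

∑-const : ∀ n c → ∑[ i < n ] c ≡ n * c
∑-const zero c = refl
∑-const (suc n) c = cong (c +_) (∑-const n c)

∑-≥ : ∀ n (f : Fin n → ℕ) i → f i ≤ sum f
∑-≥ (suc n) f Fin.zero = m≤m+n _ _
∑-≥ (suc n) f (Fin.suc i) = ≤-trans (∑-≥ n (f ∘ Fin.suc) i) (m≤n+m _ _)

sumℕ-∑-comm : ∀ n d (f : Fin d → ℕ → ℕ) → ∑ℕ[ x < n ] (∑[ i < d ] f i x) ≡ ∑[ i < d ] sumℕ n (f i)
sumℕ-∑-comm n zero f = sumℕ-zero n (λ _ _ → refl)
sumℕ-∑-comm n (suc d) f = trans (sumℕ-distrib-+ n (f Fin.zero) _) (cong (sumℕ n (f Fin.zero) +_) (sumℕ-∑-comm n d (f ∘ Fin.suc)))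

countFin≡∑𝟙 : ∀ r (P : Fin r → Set) (P? : ∀ l → Dec (P l)) → countFin r P P? ≡ ∑[ l < r ] 𝟙 (P? l)
countFin≡∑𝟙 zero P P? = refl
countFin≡∑𝟙 (suc r) P P? with P? Fin.zero
... | yes _ = cong suc (countFin≡∑𝟙 r _ _)
... | no _ = countFin≡∑𝟙 r _ _

∑𝟙≥1 : ∀ {r} {P : Fin r → Set} (P? : ∀ l → Dec (P l)) l → P l → 1 ≤ ∑[ l < r ] 𝟙 (P? l)
∑𝟙≥1 {r} P? l x = ≤-trans (≤-reflexive (sym (𝟙-yes (P? l) x))) (∑-≥ r (λ l → 𝟙 (P? l)) l)

∑𝟙≥1⇒∃ : ∀ r {P : Fin r → Set} (P? : ∀ l → Dec (P l)) → 1 ≤ ∑[ l < r ] 𝟙 (P? l) → Σ (Fin r) P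
∑𝟙≥1⇒∃ (suc r) P? ≥1 with P? Fin.zero
... | yes x = Fin.zero , x
... | no _ with ∑𝟙≥1⇒∃ r (P? ∘ Fin.suc) ≥1
...   | l , x = Fin.suc l , x

∑𝟙≥2 : ∀ r {P : Fin r → Set} (P? : ∀ l → Dec (P l)) {l l′} → l ≢ l′ → P l → P l′ →
  2 ≤ ∑[ l < r ] 𝟙 (P? l)
∑𝟙≥2 (suc r) P? {Fin.zero} {Fin.zero} l≢l′ _ _ = ⊥-elim (l≢l′ refl)
∑𝟙≥2 (suc r) P? {Fin.zero} {Fin.suc l′} _ x y =
  +-mono-≤ (≤-reflexive (sym (𝟙-yes (P? Fin.zero) x))) (∑𝟙≥1 (P? ∘ Fin.suc) l′ y)
∑𝟙≥2 (suc r) P? {Fin.suc l} {Fin.zero} _ x y =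
  +-mono-≤ (≤-reflexive (sym (𝟙-yes (P? Fin.zero) y))) (∑𝟙≥1 (P? ∘ Fin.suc) l x)
∑𝟙≥2 (suc r) P? {Fin.suc l} {Fin.suc l′} l≢l′ x y =
  ≤-trans (∑𝟙≥2 r (P? ∘ Fin.suc) (l≢l′ ∘ cong Fin.suc) x y) (m≤n+m _ _)

∑𝟙≤1 : ∀ r {P : Fin r → Set} (P? : ∀ l → Dec (P l)) → (∀ l l′ → P l → P l′ → l ≡ l′) →
  ∑[ l < r ] 𝟙 (P? l) ≤ 1
∑𝟙≤1 zero P? unique = z≤n
∑𝟙≤1 (suc r) P? unique with P? Fin.zero
... | yes x = ≤-reflexive (cong suc (trans (sum-cong-≗ others) (trans (∑-const r 0) (*-zeroʳ r))))
  where
  others : ∀ l → 𝟙 (P? (Fin.suc l)) ≡ 0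
  others l = 𝟙-no (P? (Fin.suc l)) (λ y → Fin.0≢1+n (unique _ _ x y))
... | no _ = ∑𝟙≤1 r (P? ∘ Fin.suc) (λ l l′ x y → Fin.suc-injective (unique _ _ x y))

∑𝟙≤1⇒unique : ∀ r {P : Fin r → Set} (P? : ∀ l → Dec (P l)) → ∑[ l < r ] 𝟙 (P? l) ≤ 1 →
  ∀ l l′ → P l → P l′ → l ≡ l′
∑𝟙≤1⇒unique r P? ≤1 l l′ x y with l Fin.≟ l′
... | yes l≡l′ = l≡l′
... | no l≢l′ = ⊥-elim (<-irrefl refl (≤-trans (∑𝟙≥2 r P? l≢l′ x y) ≤1))

prodFin-cong : ∀ d {f g : Fin d → ℕ} → (∀ i → f i ≡ g i) → prodFin d f ≡ prodFin d g
prodFin-cong zero eq = refl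
prodFin-cong (suc d) eq = cong₂ _*_ (eq Fin.zero) (prodFin-cong d (eq ∘ Fin.suc))

prodFin-mono : ∀ d {f g : Fin d → ℕ} → (∀ i → f i ≤ g i) → prodFin d f ≤ prodFin d g
prodFin-mono zero le = ≤-refl
prodFin-mono (suc d) le = *-mono-≤ (le Fin.zero) (prodFin-mono d (le ∘ Fin.suc))

prodFin-distrib-* : ∀ d (f g : Fin d → ℕ) → prodFin d (λ i → f i * g i) ≡ prodFin d f * prodFin d g
prodFin-distrib-* zero f g = refl
prodFin-distrib-* (suc d) f g =
  trans (cong (f Fin.zero * g Fin.zero *_) (prodFin-distrib-* d (f ∘ Fin.suc) (g ∘ Fin.suc)))
        (solve 4 (λ a b c e → a :* b :* (c :* e) := a :* c :* (b :* e)) refl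
           (f Fin.zero) (g Fin.zero) (prodFin d (f ∘ Fin.suc)) (prodFin d (g ∘ Fin.suc)))

prodFin-const : ∀ d c → prodFin d (λ _ → c) ≡ c ^ d
prodFin-const zero c = refl
prodFin-const (suc d) c = cong (c *_) (prodFin-const d c)

prodFin-factor : ∀ d (f : Fin d → ℕ) i → Σ ℕ λ w → prodFin d f ≡ w * f i
prodFin-factor (suc d) f Fin.zero = prodFin d (f ∘ Fin.suc) , *-comm (f Fin.zero) _
prodFin-factor (suc d) f (Fin.suc i) with prodFin-factor d (f ∘ Fin.suc) i
... | w , eq = f Fin.zero * w , trans (cong (f Fin.zero *_) eq) (sym (*-assoc (f Fin.zero) w (f (Fin.suc i))))

prodFin-pos : ∀ d (f : Fin d → ℕ) → (∀ i → 1 ≤ f i) → 1 ≤ prodFin d f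
prodFin-pos zero f pos = ≤-refl
prodFin-pos (suc d) f pos = *-mono-≤ (pos Fin.zero) (prodFin-pos d (f ∘ Fin.suc) (pos ∘ Fin.suc))

factor≤prodFin : ∀ d (f : Fin d → ℕ) → (∀ i → 1 ≤ f i) → ∀ i → f i ≤ prodFin d f
factor≤prodFin (suc d) f pos Fin.zero =
  m≤m*n (f Fin.zero) _ {{>-nonZero (prodFin-pos d (f ∘ Fin.suc) (pos ∘ Fin.suc))}}
factor≤prodFin (suc d) f pos (Fin.suc i) =
  ≤-trans (factor≤prodFin d (f ∘ Fin.suc) (pos ∘ Fin.suc) i) (m≤n*m _ (f Fin.zero) {{>-nonZero (pos Fin.zero)}})

prodFin-𝟙 : ∀ d {P : Fin d → Set} (P? : ∀ i → Dec (P i)) (all? : Dec (∀ i → P i)) →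
  prodFin d (λ i → 𝟙 (P? i)) ≡ 𝟙 all?
prodFin-𝟙 zero P? all? = sym (𝟙-yes all? (λ ()))
prodFin-𝟙 (suc d) P? all? with P? Fin.zero
... | yes x = trans (+-identityʳ _) (trans (prodFin-𝟙 d (P? ∘ Fin.suc) (Fin.all? (P? ∘ Fin.suc)))
                (𝟙-cong (Fin.all? (P? ∘ Fin.suc)) all? (Fin.∀-cons x) (_∘ Fin.suc)))
... | no ¬x = sym (𝟙-no all? (λ all → ¬x (all Fin.zero)))

-- Bernoulli's inequality: if x i ≥ (1 - 1/U) y i for all i, then ∏ x ≥ (1 - d/U) ∏ y.
prodFin-bernoulli : ∀ d U (x y : Fin d → ℕ) → (∀ i → x i ≤ y i) → (∀ i → U * y i ≤ U * x i + y i) →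
  U * prodFin d y ≤ U * prodFin d x + d * prodFin d y
prodFin-bernoulli zero U x y _ _ = ≤-reflexive (sym (+-identityʳ _))
prodFin-bernoulli (suc d) U x y x≤y close = begin
  U * (y₀ * Y)                           ≡⟨ sym (*-assoc U y₀ Y) ⟩
  U * y₀ * Y                             ≤⟨ *-monoˡ-≤ Y (close Fin.zero) ⟩
  (U * x₀ + y₀) * Y                      ≡⟨ solve 4 (λ U x₀ y₀ Y → (U :* x₀ :+ y₀) :* Y := x₀ :* (U :* Y) :+ y₀ :* Y)
                                              refl U x₀ y₀ Y ⟩
  x₀ * (U * Y) + y₀ * Y                  ≤⟨ +-monoˡ-≤ (y₀ * Y) (*-monoʳ-≤ x₀ ih) ⟩
  x₀ * (U * X + d * Y) + y₀ * Y          ≡⟨ cong (_+ y₀ * Y) (solve 5 (λ x₀ U X d Y →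
                                              x₀ :* (U :* X :+ d :* Y) := U :* (x₀ :* X) :+ d :* (x₀ :* Y)) refl x₀ U X d Y) ⟩
  U * (x₀ * X) + d * (x₀ * Y) + y₀ * Y   ≤⟨ +-monoˡ-≤ (y₀ * Y) (+-monoʳ-≤ (U * (x₀ * X)) (*-monoʳ-≤ d (*-monoˡ-≤ Y (x≤y Fin.zero)))) ⟩
  U * (x₀ * X) + d * (y₀ * Y) + y₀ * Y   ≡⟨ solve 3 (λ a d b → a :+ d :* b :+ b := a :+ (con 1 :+ d) :* b)
                                              refl (U * (x₀ * X)) d (y₀ * Y) ⟩
  U * (x₀ * X) + suc d * (y₀ * Y)        ∎
  where
  open ≤-Reasoning
  x₀ = x Fin.zero
  y₀ = y Fin.zero
  X = prodFin d (x ∘ Fin.suc)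
  Y = prodFin d (y ∘ Fin.suc)
  ih = prodFin-bernoulli d U (x ∘ Fin.suc) (y ∘ Fin.suc) (x≤y ∘ Fin.suc) (close ∘ Fin.suc)

[n*m+o]%n≡o : ∀ n .{{_ : NonZero n}} m o → o < n → (n * m + o) % n ≡ o
[n*m+o]%n≡o n m o o<n = begin
  (n * m + o) % n ≡⟨ cong (_% n) (trans (+-comm (n * m) o) (cong (o +_) (*-comm n m))) ⟩
  (o + m * n) % n ≡⟨ [m+kn]%n≡m%n o m n ⟩
  o % n           ≡⟨ m<n⇒m%n≡m o<n ⟩
  o               ∎
  where open ≡-Reasoning

m≡n*[m/n]+m%n : ∀ m n .{{_ : NonZero n}} → m ≡ n * (m / n) + m % n
m≡n*[m/n]+m%n m n = trans (m≡m%n+[m/n]*n m n) (trans (+-comm (m % n) _) (cong (_+ m % n) (*-comm (m / n) n)))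

[n*m+o]/n≡m : ∀ n .{{_ : NonZero n}} m o → o < n → (n * m + o) / n ≡ m
[n*m+o]/n≡m n m o o<n = *-cancelˡ-≡ _ m n (+-cancelʳ-≡ o _ _ (begin
  n * ((n * m + o) / n) + o                 ≡⟨ cong (n * ((n * m + o) / n) +_) ([n*m+o]%n≡o n m o o<n) ⟨
  n * ((n * m + o) / n) + (n * m + o) % n   ≡⟨ m≡n*[m/n]+m%n (n * m + o) n ⟨
  n * m + o                                 ∎))
  where open ≡-Reasoning

toℕ-mod : ∀ m n .{{_ : NonZero n}} → toℕ (m mod n) ≡ m % n
toℕ-mod m n = Fin.toℕ-fromℕ< (m%n<n m n)

toℕ-mod-< : ∀ {m n} .{{_ : NonZero n}} → m < n → toℕ (m mod n) ≡ m
toℕ-mod-< {m} {n} m<n = trans (toℕ-mod m n) (m<n⇒m%n≡m m<n)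

%≡⇒mod≡ : ∀ {m m′} n .{{_ : NonZero n}} → m % n ≡ m′ % n → m mod n ≡ m′ mod n
%≡⇒mod≡ {m} {m′} n eq = Fin.toℕ-injective (trans (toℕ-mod m n) (trans eq (sym (toℕ-mod m′ n))))

m<k*n⇒m%n+o<n⇒m+o<k*n : ∀ n .{{_ : NonZero n}} k m o → m < k * n → m % n + o < n → m + o < k * n
m<k*n⇒m%n+o<n⇒m+o<k*n n k m o m<kn carry-free = begin-strict
  m + o                         ≡⟨ cong (_+ o) (m≡n*[m/n]+m%n m n) ⟩
  n * (m / n) + m % n + o       ≡⟨ +-assoc (n * (m / n)) (m % n) o ⟩
  n * (m / n) + (m % n + o)     <⟨ +-monoʳ-< (n * (m / n)) carry-free ⟩
  n * (m / n) + n               ≡⟨ trans (+-comm (n * (m / n)) n) (cong (n +_) (*-comm n (m / n))) ⟩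
  suc (m / n) * n               ≤⟨ *-monoˡ-≤ n (m<n*o⇒m/o<n {m} {k} {n} m<kn) ⟩
  k * n                         ∎
  where open ≤-Reasoning

sumℕ-divmod : ∀ k R .{{_ : NonZero R}} (g : ℕ → ℕ → ℕ) →
  ∑ℕ[ s < k * R ] g (s % R) (s / R) ≡ ∑ℕ[ c < k ] ∑ℕ[ y < R ] g y c
sumℕ-divmod k R g = trans (sumℕ-* k R _) (sumℕ-cong k (λ c _ → sumℕ-cong R (λ y y<R →
  cong₂ g ([n*m+o]%n≡o R c y y<R) ([n*m+o]/n≡m R c y y<R))))

-- Periodic functions, affine reindexing and the Chinese remainder theorem

Periodic : (m : ℕ) .{{_ : NonZero m}} → (ℕ → ℕ) → Set
Periodic m f = ∀ y → f y ≡ f (y % m)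

[m+n]%o≡m%o⇒o∣n : ∀ o .{{_ : NonZero o}} m n → (m + n) % o ≡ m % o → o ∣ n
[m+n]%o≡m%o⇒o∣n o m n eq = divides (q₂ ∸ q₁) (begin
  n                     ≡⟨ m+n∸m≡n (q₁ * o) n ⟨
  q₁ * o + n ∸ q₁ * o   ≡⟨ cong (_∸ q₁ * o) same-quotient ⟩
  q₂ * o ∸ q₁ * o       ≡⟨ *-distribʳ-∸ o q₂ q₁ ⟨
  (q₂ ∸ q₁) * o         ∎)
  where
  open ≡-Reasoning
  q₁ = m / o
  q₂ = (m + n) / o
  same-quotient : q₁ * o + n ≡ q₂ * o
  same-quotient = +-cancelˡ-≡ (m % o) _ _ (begin
    m % o + (q₁ * o + n)  ≡⟨ +-assoc (m % o) (q₁ * o) n ⟨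
    m % o + q₁ * o + n    ≡⟨ cong (_+ n) (m≡m%n+[m/n]*n m o) ⟨
    m + n                 ≡⟨ m≡m%n+[m/n]*n (m + n) o ⟩
    (m + n) % o + q₂ * o  ≡⟨ cong (_+ q₂ * o) eq ⟩
    m % o + q₂ * o        ∎)

m∣n<m⇒n≡0 : ∀ {m n} → m ∣ n → n < m → n ≡ 0
m∣n<m⇒n≡0 {n = zero} _ _ = refl
m∣n<m⇒n≡0 {n = suc n} m∣n n<m = ⊥-elim (<⇒≱ n<m (∣⇒≤ m∣n))

module _ (m : ℕ) .{{_ : NonZero m}} (A u : ℕ) (coprime : ∀ z → m ∣ A * z → m ∣ z) where

  private
    affine-injective-≤ : ∀ a b → a ≤ b → b < m → (u + A * a) % m ≡ (u + A * b) % m → a ≡ b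
    affine-injective-≤ a b a≤b b<m eq = ≤-antisym a≤b (m∸n≡0⇒m≤n (m∣n<m⇒n≡0 m∣b-a (≤-<-trans (m∸n≤m b a) b<m)))
      where
      b≡a+[b-a] : u + A * b ≡ u + A * a + A * (b ∸ a)
      b≡a+[b-a] = trans (cong (λ z → u + A * z) (sym (m+[n∸m]≡n a≤b)))
        (solve 4 (λ u A a δ → u :+ A :* (a :+ δ) := u :+ A :* a :+ A :* δ) refl u A a (b ∸ a))
      m∣b-a : m ∣ b ∸ a
      m∣b-a = coprime (b ∸ a) ([m+n]%o≡m%o⇒o∣n m (u + A * a) (A * (b ∸ a)) (trans (cong (_% m) (sym b≡a+[b-a])) (sym eq)))

  affine-injective : ∀ a b → a < m → b < m → (u + A * a) % m ≡ (u + A * b) % m → a ≡ b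
  affine-injective a b a<m b<m eq with ≤-total a b
  ... | inj₁ a≤b = affine-injective-≤ a b a≤b b<m eq
  ... | inj₂ b≤a = sym (affine-injective-≤ b a b≤a a<m (sym eq))

  -- a ↦ (u + A a) mod m is injective on [0, m), so every residue z is hit exactly once
  sumℕ-affine : (f : ℕ → ℕ) → Periodic m f → ∑ℕ[ a < m ] f (u + A * a) ≡ sumℕ m f
  sumℕ-affine f periodic = begin
    ∑ℕ[ a < m ] f (u + A * a)                      ≡⟨ sumℕ-cong m (λ a _ → trans (periodic _) (sym (sumℕ-hit (u + A * a)))) ⟩
    ∑ℕ[ a < m ] ∑ℕ[ z < m ] (hit a z * f z)        ≡⟨ sumℕ-comm m m (λ a z → hit a z * f z) ⟩
    ∑ℕ[ z < m ] ∑ℕ[ a < m ] (hit a z * f z)        ≡⟨ sumℕ-cong m (λ z _ → trans (sumℕ-cong m (λ a _ → *-comm (hit a z) (f z)))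
                                                                                  (sym (*-distribˡ-sumℕ (f z) m (λ a → hit a z)))) ⟩
    ∑ℕ[ z < m ] (f z * ∑ℕ[ a < m ] hit a z)        ≡⟨ sumℕ-cong m (λ z z<m → trans (cong (f z *_) (hits-once z z<m)) (*-identityʳ (f z))) ⟩
    sumℕ m f                                       ∎
    where
    open ≡-Reasoning
    hit : ℕ → ℕ → ℕ
    hit a z = 𝟙 ((u + A * a) % m ≟ z)
    sumℕ-hit : ∀ w → ∑ℕ[ z < m ] (𝟙 (w % m ≟ z) * f z) ≡ f (w % m)
    sumℕ-hit w = trans (sumℕ-single m (w % m) (m%n<n w m) (λ z _ z≢w → cong (_* f z) (𝟙-no (w % m ≟ z) (z≢w ∘ sym))))
                       (trans (cong (_* f (w % m)) (𝟙-yes (w % m ≟ w % m) refl)) (+-identityʳ _))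
    hits-total : ∑ℕ[ z < m ] ∑ℕ[ a < m ] hit a z ≡ m
    hits-total = begin
      ∑ℕ[ z < m ] ∑ℕ[ a < m ] hit a z       ≡⟨ sumℕ-comm m m (λ a z → hit a z) ⟨
      ∑ℕ[ a < m ] ∑ℕ[ z < m ] hit a z       ≡⟨ sumℕ-cong m (λ a _ → sumℕ-single m _ (m%n<n (u + A * a) m)
                                                   (λ z _ z≢w → 𝟙-no ((u + A * a) % m ≟ z) (z≢w ∘ sym))) ⟩
      ∑ℕ[ a < m ] hit a ((u + A * a) % m)   ≡⟨ sumℕ-cong m (λ a _ → 𝟙-yes ((u + A * a) % m ≟ _) refl) ⟩
      ∑ℕ[ a < m ] 1                         ≡⟨ trans (sumℕ-const m 1) (*-identityʳ m) ⟩
      m                                     ∎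
    hits-once : ∀ z → z < m → ∑ℕ[ a < m ] hit a z ≡ 1
    hits-once = sumℕ≡n⇒all≡1 m (λ z _ → sumℕ-≤1 m (λ a _ → 𝟙≤1 _)
                  (λ a b a<m b<m ha hb → affine-injective a b a<m b<m
                     (trans (𝟙≡1⇒ ((u + A * a) % m ≟ _) ha) (sym (𝟙≡1⇒ ((u + A * b) % m ≟ _) hb)))))
                  hits-total

prodFin-periodic : ∀ d (m : Fin d → ℕ) (nz : ∀ i → NonZero (m i)) (f : Fin d → ℕ → ℕ) →
  (∀ i → Periodic (m i) {{nz i}} (f i)) →
  ∀ y c → prodFin d (λ i → f i (y + prodFin d m * c)) ≡ prodFin d (λ i → f i y)
prodFin-periodic zero m nz f periodic y c = refl
prodFin-periodic (suc d) m nz f periodic y c = cong₂ _*_ first rest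
  where
  instance _ = nz Fin.zero
  m₀ = m Fin.zero
  f₀ = f Fin.zero
  M = prodFin d (m ∘ Fin.suc)
  first : f₀ (y + m₀ * M * c) ≡ f₀ y
  first = begin
    f₀ (y + m₀ * M * c)         ≡⟨ periodic Fin.zero _ ⟩
    f₀ ((y + m₀ * M * c) % m₀)  ≡⟨ cong (λ z → f₀ ((y + z) % m₀)) (solve 3 (λ a b c → a :* b :* c := b :* c :* a) refl m₀ M c) ⟩
    f₀ ((y + M * c * m₀) % m₀)  ≡⟨ cong f₀ ([m+kn]%n≡m%n y (M * c) m₀) ⟩
    f₀ (y % m₀)                 ≡⟨ periodic Fin.zero y ⟨
    f₀ y                        ∎
    where open ≡-Reasoning
  rest : prodFin d (λ i → f (Fin.suc i) (y + m₀ * M * c)) ≡ prodFin d (λ i → f (Fin.suc i) y)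
  rest = trans (cong (λ z → prodFin d (λ i → f (Fin.suc i) (y + z))) (solve 3 (λ a b c → a :* b :* c := b :* (a :* c)) refl m₀ M c))
               (prodFin-periodic d (m ∘ Fin.suc) (λ i → nz (Fin.suc i)) (f ∘ Fin.suc) (λ i → periodic (Fin.suc i)) y (m₀ * c))

prodFin-coprime : ∀ d (m : Fin d → ℕ) n → (∀ i z → n ∣ m i * z → n ∣ z) → ∀ z → n ∣ prodFin d m * z → n ∣ z
prodFin-coprime zero m n coprime z n∣z = subst (n ∣_) (+-identityʳ z) n∣z
prodFin-coprime (suc d) m n coprime z n∣mz =
  prodFin-coprime d (m ∘ Fin.suc) n (coprime ∘ Fin.suc) z
    (coprime Fin.zero _ (subst (n ∣_) (*-assoc (m Fin.zero) _ z) n∣mz))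

-- Writing x = M a + b with M the product of the other moduli, the first factor is evaluated at
-- t + b + M a for a < m₀, a complete residue system mod m₀ because M is invertible mod m₀,
-- while the other factors do not depend on a.
sumℕ-prodFin-crt : ∀ d (m : Fin d → ℕ) (nz : ∀ i → NonZero (m i)) →
  (∀ i j → i ≢ j → ∀ z → m i ∣ m j * z → m i ∣ z) →
  (f : Fin d → ℕ → ℕ) → (∀ i → Periodic (m i) {{nz i}} (f i)) →
  ∀ t → ∑ℕ[ x < prodFin d m ] prodFin d (λ i → f i (t + x)) ≡ prodFin d (λ i → sumℕ (m i) (f i))
sumℕ-prodFin-crt zero m nz coprime f periodic t = refl
sumℕ-prodFin-crt (suc d) m nz coprime f periodic t = begin
  sumℕ (m₀ * M) G                                          ≡⟨ sumℕ-* m₀ M G ⟩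
  ∑ℕ[ a < m₀ ] ∑ℕ[ b < M ] G (M * a + b)                   ≡⟨ sumℕ-cong m₀ (λ a _ → sumℕ-cong M (λ b _ → split a b)) ⟩
  ∑ℕ[ a < m₀ ] ∑ℕ[ b < M ] (f₀ (t + b + M * a) * F (t + b)) ≡⟨ sumℕ-comm m₀ M _ ⟩
  ∑ℕ[ b < M ] ∑ℕ[ a < m₀ ] (f₀ (t + b + M * a) * F (t + b)) ≡⟨ sumℕ-cong M (λ b _ → factor-out b) ⟩
  ∑ℕ[ b < M ] (S₀ * F (t + b))                             ≡⟨ *-distribˡ-sumℕ S₀ M (λ b → F (t + b)) ⟨
  S₀ * ∑ℕ[ b < M ] F (t + b)                               ≡⟨ cong (S₀ *_) (sumℕ-prodFin-crt d (m ∘ Fin.suc) (λ i → nz (Fin.suc i))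
                                                                (λ i j i≢j → coprime (Fin.suc i) (Fin.suc j) (i≢j ∘ Fin.suc-injective))
                                                                (f ∘ Fin.suc) (λ i → periodic (Fin.suc i)) t) ⟩
  S₀ * prodFin d (λ i → sumℕ (m (Fin.suc i)) (f (Fin.suc i))) ∎
  where
  open ≡-Reasoning
  instance _ = nz Fin.zero
  m₀ = m Fin.zero
  M = prodFin d (m ∘ Fin.suc)
  f₀ = f Fin.zero
  S₀ = sumℕ m₀ f₀
  F : ℕ → ℕ
  F y = prodFin d (λ i → f (Fin.suc i) y)
  G : ℕ → ℕ
  G x = prodFin (suc d) (λ i → f i (t + x))
  split : ∀ a b → G (M * a + b) ≡ f₀ (t + b + M * a) * F (t + b)
  split a b = cong₂ _*_ (cong f₀ reorder)
    (trans (cong F reorder) (prodFin-periodic d (m ∘ Fin.suc) (λ i → nz (Fin.suc i)) (f ∘ Fin.suc) (λ i → periodic (Fin.suc i)) (t + b) a))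
    where
    reorder : t + (M * a + b) ≡ t + b + M * a
    reorder = solve 4 (λ t M a b → t :+ (M :* a :+ b) := t :+ b :+ M :* a) refl t M a b
  factor-out : ∀ b → ∑ℕ[ a < m₀ ] (f₀ (t + b + M * a) * F (t + b)) ≡ S₀ * F (t + b)
  factor-out b = begin
    ∑ℕ[ a < m₀ ] (f₀ (t + b + M * a) * F (t + b))  ≡⟨ sumℕ-cong m₀ (λ a _ → *-comm _ (F (t + b))) ⟩
    ∑ℕ[ a < m₀ ] (F (t + b) * f₀ (t + b + M * a))  ≡⟨ *-distribˡ-sumℕ (F (t + b)) m₀ _ ⟨
    F (t + b) * ∑ℕ[ a < m₀ ] f₀ (t + b + M * a)    ≡⟨ cong (F (t + b) *_) (sumℕ-affine m₀ M (t + b)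
                                                        (prodFin-coprime d (m ∘ Fin.suc) m₀ (λ i → coprime Fin.zero (Fin.suc i) (λ ())))
                                                        f₀ (periodic Fin.zero)) ⟩
    F (t + b) * S₀                                 ≡⟨ *-comm (F (t + b)) S₀ ⟩
    S₀ * F (t + b)                                 ∎

prime>1 : ∀ {p} → Prime p → 1 < p
prime>1 {p} p-prime = nonTrivial⇒n>1 p {{prime⇒nonTrivial p-prime}}

prime∤prime^ : ∀ {p p′} → Prime p → Prime p′ → p ≢ p′ → ∀ e → ¬ (p ∣ p′ ^ e)
prime∤prime^ p-prime p′-prime p≢p′ zero p∣1 = <-irrefl (sym (∣1⇒≡1 p∣1)) (prime>1 p-prime)
prime∤prime^ {p} {p′} p-prime p′-prime p≢p′ (suc e) p∣p′^e+1 with euclidsLemma p′ (p′ ^ e) p-prime p∣p′^e+1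
... | inj₂ p∣p′^e = prime∤prime^ p-prime p′-prime p≢p′ e p∣p′^e
... | inj₁ p∣p′ with prime⇒irreducible p′-prime p∣p′
...   | inj₁ p≡1 = <-irrefl (sym p≡1) (prime>1 p-prime)
...   | inj₂ p≡p′ = p≢p′ p≡p′

prime^-coprime : ∀ {p} {n} → Prime p → ¬ (p ∣ n) → ∀ e z → p ^ e ∣ n * z → p ^ e ∣ z
prime^-coprime p-prime p∤n zero z _ = 1∣ z
prime^-coprime {p} {n} p-prime p∤n (suc e) z p^e+1∣nz
  with euclidsLemma n z p-prime (∣-trans (m∣m*n (p ^ e)) p^e+1∣nz)
... | inj₁ p∣n = ⊥-elim (p∤n p∣n)
... | inj₂ (divides z′ refl) = subst (p * p ^ e ∣_) (*-comm p z′) (*-monoʳ-∣ p p^e∣z′)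
  where
  instance _ = prime⇒nonZero p-prime
  p^e∣nz′ : p ^ e ∣ n * z′
  p^e∣nz′ = *-cancelˡ-∣ p (subst (p * p ^ e ∣_) (solve 3 (λ n z p → n :* (z :* p) := p :* (n :* z)) refl n z′ p) p^e+1∣nz)
  p^e∣z′ : p ^ e ∣ z′
  p^e∣z′ = prime^-coprime p-prime p∤n e z′ p^e∣nz′

n<m^n : ∀ m → 2 ≤ m → ∀ n → n < m ^ n
n<m^n m 2≤m zero = s≤s z≤n
n<m^n m 2≤m (suc n) = begin-strict
  suc n          ≤⟨ n<m^n m 2≤m n ⟩
  m ^ n          <⟨ m<m+n (m ^ n) (≤-<-trans z≤n (n<m^n m 2≤m n)) ⟩
  m ^ n + m ^ n  ≡⟨ cong (m ^ n +_) (+-identityʳ (m ^ n)) ⟨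
  2 * m ^ n      ≤⟨ *-monoˡ-≤ (m ^ n) 2≤m ⟩
  m * m ^ n      ∎
  where open ≤-Reasoning

power-between : ∀ m → 2 ≤ m → ∀ x → 1 ≤ x → Σ ℕ λ L → x ≤ m ^ L × m ^ L ≤ m * x
power-between m 2≤m x 1≤x with scan x
  where
  scan : ∀ n → m ^ n < x ⊎ (Σ ℕ λ L → x ≤ m ^ L × m ^ L ≤ m * x)
  scan zero with 1 <? x
  ... | yes 1<x = inj₁ 1<x
  ... | no 1≮x = inj₂ (0 , ≮⇒≥ 1≮x , ≤-trans 1≤x (m≤n*m x m {{>-nonZero (≤-trans (s≤s z≤n) 2≤m)}}))
  scan (suc n) with scan n
  ... | inj₂ found = inj₂ found
  ... | inj₁ m^n<x with m ^ suc n <? x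
  ...   | yes m^n+1<x = inj₁ m^n+1<x
  ...   | no m^n+1≮x = inj₂ (suc n , ≮⇒≥ m^n+1≮x , *-monoʳ-≤ m (<⇒≤ m^n<x))
... | inj₁ m^x<x = ⊥-elim (<-asym m^x<x (n<m^n m 2≤m x))
... | inj₂ found = found

∣⊖∣≡∣-∣ : ∀ m n → ∣ m ⊖ n ∣ ≡ ∣ m - n ∣
∣⊖∣≡∣-∣ m n with ≤-total m n
... | inj₁ m≤n = trans (ℤ.∣⊖∣-≤ m≤n) (sym (m≤n⇒∣m-n∣≡n∸m m≤n))
... | inj₂ n≤m = trans (ℤ.∣m⊖n∣≡∣n⊖m∣ m n) (trans (ℤ.∣⊖∣-≤ n≤m) (sym (m≤n⇒∣n-m∣≡n∸m n≤m)))

∣kS-N[k-1]∣≡∣N-kC∣ : ∀ k N S C → 1 ≤ k → S + C ≡ N → ∣ ⁺ (k * S) ℤ.- ⁺ (N * (k ∸ 1)) ∣ ≡ ∣ N - k * C ∣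
∣kS-N[k-1]∣≡∣N-kC∣ k N S C 1≤k S+C≡N = begin
  ∣ ⁺ (k * S) ℤ.- ⁺ b ∣              ≡⟨ cong ∣_∣ (ℤ.[+m]-[+n]≡m⊖n (k * S) b) ⟩
  ∣ k * S ⊖ b ∣                      ≡⟨ ∣⊖∣≡∣-∣ (k * S) b ⟩
  ∣ k * S - b ∣                      ≡⟨ ∣m+n-m+o∣≡∣n-o∣ (k * C) (k * S) b ⟨
  ∣ k * C + k * S - k * C + b ∣      ≡⟨ cong₂ ∣_-_∣ kC+kS≡b+N (+-comm (k * C) b) ⟩
  ∣ b + N - b + k * C ∣              ≡⟨ ∣m+n-m+o∣≡∣n-o∣ b N (k * C) ⟩
  ∣ N - k * C ∣                      ∎
  where
  open ≡-Reasoning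
  b = N * (k ∸ 1)
  kC+kS≡b+N : k * C + k * S ≡ b + N
  kC+kS≡b+N = begin
    k * C + k * S        ≡⟨ trans (+-comm (k * C) (k * S)) (sym (*-distribˡ-+ k S C)) ⟩
    k * (S + C)          ≡⟨ cong (k *_) S+C≡N ⟩
    k * N                ≡⟨ *-comm k N ⟩
    N * k                ≡⟨ cong (N *_) (m∸n+n≡m 1≤k) ⟨
    N * (k ∸ 1 + 1)      ≡⟨ trans (*-distribˡ-+ N (k ∸ 1) 1) (cong (b +_) (*-identityʳ N)) ⟩
    b + N                ∎

module ℤ^ (p : ℕ) .{{_ : NonZero p}} where

  private
    infix 4 _≈_
    _≈_ : ℕ → ℕ → Set
    x ≈ y = x % p ≡ y % p

    ≈-+ʳ : ∀ w {x y} → x ≈ y → x + w ≈ y + w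
    ≈-+ʳ w {x} {y} eq = begin
      (x + w) % p          ≡⟨ %-distribˡ-+ x w p ⟩
      (x % p + w % p) % p  ≡⟨ cong (λ z → (z + w % p) % p) eq ⟩
      (y % p + w % p) % p  ≡⟨ %-distribˡ-+ y w p ⟨
      (y + w) % p          ∎
      where open ≡-Reasoning

    ≈-+ˡ : ∀ w {x y} → x ≈ y → w + x ≈ w + y
    ≈-+ˡ w {x} {y} eq = subst₂ _≈_ (+-comm x w) (+-comm y w) (≈-+ʳ w eq)

    ≈-shift : ∀ w {x y x′ y′} → x ≈ y → x + w ≡ x′ + p → y + w ≡ y′ + p → x′ ≈ y′
    ≈-shift w {x} {y} {x′} {y′} eq x+w≡x′+p y+w≡y′+p = begin
      x′ % p        ≡⟨ [m+n]%n≡m%n x′ p ⟨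
      (x′ + p) % p  ≡⟨ cong (_% p) x+w≡x′+p ⟨
      (x + w) % p   ≡⟨ ≈-+ʳ w eq ⟩
      (y + w) % p   ≡⟨ cong (_% p) y+w≡y′+p ⟩
      (y′ + p) % p  ≡⟨ [m+n]%n≡m%n y′ p ⟩
      y′ % p        ∎
      where open ≡-Reasoning

    toℕ-mod≈ : ∀ n → toℕ (n mod p) ≈ n
    toℕ-mod≈ n = trans (cong (_% p) (toℕ-mod n p)) (m%n%n≡m%n n p)

    mod-≈ : ∀ {m n} → m mod p ≡ n mod p → m ≈ n
    mod-≈ eq = trans (sym (toℕ-mod _ p)) (trans (cong toℕ eq) (toℕ-mod _ p))

    ≈⇒≡ : {a b : Fin p} → toℕ a ≈ toℕ b → a ≡ b
    ≈⇒≡ {a} {b} eq = Fin.toℕ-injective (trans (sym (m<n⇒m%n≡m (Fin.toℕ<n a))) (trans eq (m<n⇒m%n≡m (Fin.toℕ<n b))))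

    complement : (a : Fin p) → toℕ a + (p ∸ toℕ a) ≡ p
    complement a = m+[n∸m]≡n (<⇒≤ (Fin.toℕ<n a))

  0ℤ : Fin p
  0ℤ = 0 mod p

  addZ-assoc : ∀ a b c → addZ p (addZ p a b) c ≡ addZ p a (addZ p b c)
  addZ-assoc a b c = %≡⇒mod≡ p (begin
    (toℕ (addZ p a b) + C) % p  ≡⟨ ≈-+ʳ C (toℕ-mod≈ (A + B)) ⟩
    (A + B + C) % p             ≡⟨ cong (_% p) (+-assoc A B C) ⟩
    (A + (B + C)) % p           ≡⟨ ≈-+ˡ A (toℕ-mod≈ (B + C)) ⟨
    (A + toℕ (addZ p b c)) % p  ∎)
    where
    open ≡-Reasoning
    A = toℕ a ; B = toℕ b ; C = toℕ c

  addZ-identityʳ : ∀ a → addZ p a 0ℤ ≡ a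
  addZ-identityʳ a = ≈⇒≡ (trans (toℕ-mod≈ _) (trans (≈-+ˡ (toℕ a) (toℕ-mod≈ 0)) (cong (_% p) (+-identityʳ (toℕ a)))))

  addZ-cancelˡ : ∀ x u v → addZ p x u ≡ addZ p x v → u ≡ v
  addZ-cancelˡ x u v eq = ≈⇒≡ (≈-shift (p ∸ X) (mod-≈ eq) (shift u) (shift v))
    where
    X = toℕ x
    shift : ∀ w → X + toℕ w + (p ∸ X) ≡ toℕ w + p
    shift w = trans (solve 3 (λ x w c → x :+ w :+ c := w :+ (x :+ c)) refl X (toℕ w) (p ∸ X)) (cong (toℕ w +_) (complement x))

  addZ≡⇒subZ≡ : ∀ a b x y → addZ p a x ≡ addZ p b y → subZ p a b ≡ subZ p y x
  addZ≡⇒subZ≡ a b x y eq = %≡⇒mod≡ p (≈-shift ((p ∸ B) + (p ∸ X)) (mod-≈ eq) left right)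
    where
    A = toℕ a ; B = toℕ b ; X = toℕ x ; Y = toℕ y
    left : A + X + ((p ∸ B) + (p ∸ X)) ≡ A + (p ∸ B) + p
    left = trans (solve 4 (λ a x c e → a :+ x :+ (c :+ e) := a :+ c :+ (x :+ e)) refl A X (p ∸ B) (p ∸ X))
                 (cong (A + (p ∸ B) +_) (complement x))
    right : B + Y + ((p ∸ B) + (p ∸ X)) ≡ Y + (p ∸ X) + p
    right = trans (solve 4 (λ b y c e → b :+ y :+ (c :+ e) := y :+ e :+ (b :+ c)) refl B Y (p ∸ B) (p ∸ X))
                  (cong (Y + (p ∸ X) +_) (complement b))

  subZ≡⇒addZ≡ : ∀ a b x y → subZ p a b ≡ subZ p y x → addZ p a x ≡ addZ p b y
  subZ≡⇒addZ≡ a b x y eq = %≡⇒mod≡ p (≈-shift (X + B) (mod-≈ eq) left right)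
    where
    A = toℕ a ; B = toℕ b ; X = toℕ x ; Y = toℕ y
    left : A + (p ∸ B) + (X + B) ≡ A + X + p
    left = trans (solve 4 (λ a c x b → a :+ c :+ (x :+ b) := a :+ x :+ (b :+ c)) refl A (p ∸ B) X B)
                 (cong (A + X +_) (complement b))
    right : Y + (p ∸ X) + (X + B) ≡ B + Y + p
    right = trans (solve 4 (λ y e x b → y :+ e :+ (x :+ b) := b :+ y :+ (x :+ e)) refl Y (p ∸ X) X B)
                  (cong (B + Y +_) (complement x))

  0V : (m : ℕ) → ZV p m
  0V m = replicate m 0ℤ

  addV-identityʳ : ∀ {m} (a : ZV p m) → addV p a (0V m) ≡ a
  addV-identityʳ [] = refl
  addV-identityʳ (a ∷ as) = cong₂ _∷_ (addZ-identityʳ a) (addV-identityʳ as)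

  addV-assoc : ∀ {m} (a b c : ZV p m) → addV p (addV p a b) c ≡ addV p a (addV p b c)
  addV-assoc [] [] [] = refl
  addV-assoc (a ∷ as) (b ∷ bs) (c ∷ cs) = cong₂ _∷_ (addZ-assoc a b c) (addV-assoc as bs cs)

  addV-cancelˡ : ∀ {m} (x u v : ZV p m) → addV p x u ≡ addV p x v → u ≡ v
  addV-cancelˡ [] [] [] _ = refl
  addV-cancelˡ (x ∷ xs) (u ∷ us) (v ∷ vs) eq =
    cong₂ _∷_ (addZ-cancelˡ x u v (cong head eq)) (addV-cancelˡ xs us vs (cong tail eq))

  addV≡⇒subV≡ : ∀ {m} (a b x y : ZV p m) → addV p a x ≡ addV p b y → subV p a b ≡ subV p y x
  addV≡⇒subV≡ [] [] [] [] _ = refl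
  addV≡⇒subV≡ (a ∷ as) (b ∷ bs) (x ∷ xs) (y ∷ ys) eq =
    cong₂ _∷_ (addZ≡⇒subZ≡ a b x y (cong head eq)) (addV≡⇒subV≡ as bs xs ys (cong tail eq))

  subV≡⇒addV≡ : ∀ {m} (a b x y : ZV p m) → subV p a b ≡ subV p y x → addV p a x ≡ addV p b y
  subV≡⇒addV≡ [] [] [] [] _ = refl
  subV≡⇒addV≡ (a ∷ as) (b ∷ bs) (x ∷ xs) (y ∷ ys) eq =
    cong₂ _∷_ (subZ≡⇒addZ≡ a b x y (cong head eq)) (subV≡⇒addV≡ as bs xs ys (cong tail eq))

-- Difference matrices with as many rows as group elements

digits : (p k : ℕ) .{{_ : NonZero p}} → ℕ → ZV p k
digits p zero x = []
digits p (suc k) x = (x mod p) ∷ digits p k (x / p)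

digits-injective : ∀ p k .{{_ : NonZero p}} {x y} → x < p ^ k → y < p ^ k → digits p k x ≡ digits p k y → x ≡ y
digits-injective p zero {zero} {zero} _ _ _ = refl
digits-injective p zero {suc _} (s≤s ()) _ _
digits-injective p zero {zero} {suc _} _ (s≤s ()) _
digits-injective p (suc k) {x} {y} x<p^k+1 y<p^k+1 eq = begin
  x                  ≡⟨ m≡m%n+[m/n]*n x p ⟩
  x % p + x / p * p  ≡⟨ cong₂ (λ r q → r + q * p) same-last-digit same-prefix ⟩
  y % p + y / p * p  ≡⟨ m≡m%n+[m/n]*n y p ⟨
  y                  ∎
  where
  open ≡-Reasoning
  same-last-digit : x % p ≡ y % p
  same-last-digit = trans (sym (toℕ-mod x p)) (trans (cong (toℕ ∘ head) eq) (toℕ-mod y p))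
  /p< : ∀ z → z < p ^ suc k → z / p < p ^ k
  /p< z z< = m<n*o⇒m/o<n (subst (z <_) (*-comm p (p ^ k)) z<)
  same-prefix : x / p ≡ y / p
  same-prefix = digits-injective p k (/p< x x<p^k+1) (/p< y y<p^k+1) (cong tail eq)

module _ (p m : ℕ) (p-prime : Prime p) (D : Fin (p ^ m) → Fin (p ^ m) → ZV p m)
         (isD : IsDiffMatrix p m (p ^ m) (p ^ m) p-prime D) {i j : Fin (p ^ m)} (i≢j : i ≢ j) where

  private
    instance
      p≢0 : NonZero p
      p≢0 = prime⇒nonZero p-prime
      q≢0 : NonZero (p ^ m)
      q≢0 = m^n≢0 p m
    q = p ^ m

    difference : Fin q → ZV p m
    difference l = subV p (D l i) (D l j)

    count : ZV p m → ℕ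
    count g = ∑[ l < q ] 𝟙 (difference l ≟V g)

    count-constant : ∀ g h → count g ≡ count h
    count-constant g h = trans (sym (countFin≡∑𝟙 q _ (λ l → difference l ≟V g)))
                               (trans (isD i j i≢j g h) (countFin≡∑𝟙 q _ (λ l → difference l ≟V h)))

    element : Fin q → ZV p m
    element x = digits p m (toℕ x)

    element-injective : ∀ x y → element x ≡ element y → x ≡ y
    element-injective x y eq = Fin.toℕ-injective (digits-injective p m (Fin.toℕ<n x) (Fin.toℕ<n y) eq)

    count≥1 : ∀ g → 1 ≤ count g
    count≥1 g = subst (1 ≤_) (count-constant (difference row) g) (∑𝟙≥1 (λ l → difference l ≟V difference row) row refl)
      where row = Fin.fromℕ< (>-nonZero⁻¹ q)

    -- there are as many group elements as rows, and each row realises a single difference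
    count≤1 : ∀ g → count g ≤ 1
    count≤1 g = *-cancelˡ-≤ q (begin
      q * count g                                          ≡⟨ ∑-const q (count g) ⟨
      ∑[ x < q ] count g                                   ≡⟨ sum-cong-≗ (λ x → count-constant g (element x)) ⟩
      ∑[ x < q ] ∑[ l < q ] 𝟙 (difference l ≟V element x) ≡⟨ ∑-comm (λ x l → 𝟙 (difference l ≟V element x)) ⟩
      ∑[ l < q ] ∑[ x < q ] 𝟙 (difference l ≟V element x) ≤⟨ ∑-mono q (λ l → ∑𝟙≤1 q (λ x → difference l ≟V element x)
                                                                 (λ x y ex ey → element-injective x y (trans (sym ex) ey))) ⟩
      ∑[ l < q ] 1                                         ≡⟨ ∑-const q 1 ⟩
      q * 1                                                ∎)
      where open ≤-Reasoning

  diffMatrix-unique-row : ∀ X Y → ∑ℕ[ c < p ^ m ] 𝟙 (addV p (D (c mod q) i) X ≟V addV p (D (c mod q) j) Y) ≡ 1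
  diffMatrix-unique-row X Y = trans (sumℕ-single q (toℕ l₀) (Fin.toℕ<n l₀) others)
                                    (𝟙-yes (_ ≟V _) (subst solves (sym l₀-mod) (ℤ^.subV≡⇒addV≡ p _ _ X Y l₀-solves)))
    where
    solves : Fin q → Set
    solves l = addV p (D l i) X ≡ addV p (D l j) Y
    l₀ = proj₁ (∑𝟙≥1⇒∃ q (λ l → difference l ≟V subV p Y X) (count≥1 (subV p Y X)))
    l₀-solves : difference l₀ ≡ subV p Y X
    l₀-solves = proj₂ (∑𝟙≥1⇒∃ q (λ l → difference l ≟V subV p Y X) (count≥1 (subV p Y X)))
    l₀-mod : toℕ l₀ mod q ≡ l₀
    l₀-mod = Fin.toℕ-injective (toℕ-mod-< (Fin.toℕ<n l₀))
    others : ∀ c → c < q → c ≢ toℕ l₀ → 𝟙 (addV p (D (c mod q) i) X ≟V addV p (D (c mod q) j) Y) ≡ 0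
    others c c<q c≢l₀ = 𝟙-no (_ ≟V _) (λ sol → c≢l₀ (trans (sym (toℕ-mod-< c<q))
      (cong toℕ (∑𝟙≤1⇒unique q (λ l → difference l ≟V subV p Y X) (count≤1 (subV p Y X)) _ _
        (ℤ^.addV≡⇒subV≡ p _ _ X Y sol) l₀-solves))))

-- Unfolding a Rudin–Shapiro sequence along base-p^m digits

module RudinShapiro (p m : ℕ) (p-prime : Prime p)
    (M : Fin (p ^ m) → Fin (p ^ m) → ZV p m) (isD : IsDiffMatrix p m (p ^ m) (p ^ m) p-prime M)
    (a : ℕ → ZV p m) (isRS : IsRudinShapiro p m p-prime M a) where

  q : ℕ
  q = p ^ m

  instance
    p≢0 : NonZero p
    p≢0 = prime⇒nonZero p-prime
    q≢0 : NonZero q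
    q≢0 = m^n≢0 p m

  q^≢0 : ∀ L → NonZero (q ^ L)
  q^≢0 L = m^n≢0 q L

  infixl 7 _%[_] _/[_]
  _%[_] _/[_] : ℕ → ℕ → ℕ
  y %[ L ] = _%_ y (q ^ L) {{q^≢0 L}}
  y /[ L ] = _/_ y (q ^ L) {{q^≢0 L}}

  open ℤ^ p using (0V; addV-assoc; addV-identityʳ; addV-cancelˡ)

  increment : ℕ → ℕ → ℕ → ZV p m
  increment zero s c = 0V m
  increment (suc L) s c = addV p (M (c mod q) (s /[ L ] mod q)) (increment L (s %[ L ]) (s /[ L ]))

  increment-mod : ∀ L s {c c′} → c % q ≡ c′ % q → increment L s c ≡ increment L s c′
  increment-mod zero s eq = refl
  increment-mod (suc L) s eq = cong (λ r → addV p (M r (s /[ L ] mod q)) (increment L (s %[ L ]) (s /[ L ]))) (%≡⇒mod≡ q eq)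

  a-unfold : ∀ L T s → 1 ≤ T → s < q ^ L → a (q ^ L * T + s) ≡ addV p (a T) (increment L s T)
  a-unfold zero T (suc s) _ (s≤s ())
  a-unfold zero T zero 1≤T _ = trans (cong a (trans (+-identityʳ _) (*-identityˡ T))) (sym (addV-identityʳ (a T)))
  a-unfold (suc L) T s 1≤T s<q^L+1 = begin
    a (q ^ suc L * T + s)                                        ≡⟨ cong a regroup ⟩
    a (R * T′ + s₀)                                              ≡⟨ a-unfold L T′ s₀ 1≤T′ (m%n<n s R) ⟩
    addV p (a T′) (increment L s₀ T′)                            ≡⟨ cong₂ (addV p) last-digit (increment-mod L s₀ T′%q) ⟩
    addV p (addV p (a T) (M (T mod q) (d mod q))) (increment L s₀ d) ≡⟨ addV-assoc _ _ _ ⟩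
    addV p (a T) (increment (suc L) s T)                         ∎
    where
    open ≡-Reasoning
    instance _ = q^≢0 L
    R = q ^ L
    d = s / R
    s₀ = s % R
    T′ = q * T + d
    1≤T′ : 1 ≤ T′
    1≤T′ = ≤-trans (≤-trans 1≤T (m≤n*m T q)) (m≤m+n (q * T) d)
    d<q : d < q
    d<q = m<n*o⇒m/o<n s<q^L+1
    regroup : q ^ suc L * T + s ≡ R * T′ + s₀
    regroup = begin
      q * R * T + s              ≡⟨ cong (q * R * T +_) (m≡m%n+[m/n]*n s R) ⟩
      q * R * T + (s₀ + d * R)   ≡⟨ solve 5 (λ q r t s₀ d → q :* r :* t :+ (s₀ :+ d :* r) := r :* (q :* t :+ d) :+ s₀) refl q R T s₀ d ⟩
      R * T′ + s₀                ∎
    T′%q : T′ % q ≡ d % q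
    T′%q = trans (cong (_% q) (trans (+-comm (q * T) d) (cong (d +_) (*-comm q T)))) ([m+kn]%n≡m%n d T q)
    last-digit : a T′ ≡ addV p (a T) (M (T mod q) (d mod q))
    last-digit = trans (cong (λ j → a (q * T + j)) (sym (toℕ-mod-< d<q)))
                       (isRS T (d mod q) (inj₂ (λ T≡0 → <-irrefl (sym T≡0) 1≤T)))

  a-block : ∀ L y h → q ^ L ≤ y → y %[ L ] + h < q ^ L →
    a (y + h) ≡ addV p (a (y /[ L ])) (increment L (y %[ L ] + h) (y /[ L ]))
  a-block L y h q^L≤y fits = trans (cong a decompose) (a-unfold L (y /[ L ]) (y %[ L ] + h) (m≥n⇒m/n>0 q^L≤y) fits)
    where
    instance _ = q^≢0 L
    decompose : y + h ≡ q ^ L * (y /[ L ]) + (y %[ L ] + h)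
    decompose = trans (cong (_+ h) (m≡n*[m/n]+m%n y (q ^ L))) (+-assoc (q ^ L * (y /[ L ])) (y %[ L ]) h)

  a-block₀ : ∀ L y → q ^ L ≤ y → a y ≡ addV p (a (y /[ L ])) (increment L (y %[ L ]) (y /[ L ]))
  a-block₀ L y q^L≤y = trans (cong a (m≡n*[m/n]+m%n y (q ^ L)))
                             (a-unfold L (y /[ L ]) (y %[ L ]) (m≥n⇒m/n>0 q^L≤y) (m%n<n y (q ^ L)))
    where instance _ = q^≢0 L

  a≡a⇒increment≡ : ∀ L y h → q ^ L ≤ y → y %[ L ] + h < q ^ L → a y ≡ a (y + h) →
    increment L (y %[ L ]) (y /[ L ]) ≡ increment L (y %[ L ] + h) (y /[ L ])
  a≡a⇒increment≡ L y h q^L≤y fits eq =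
    addV-cancelˡ (a (y /[ L ])) _ _ (trans (sym (a-block₀ L y q^L≤y)) (trans eq (a-block L y h q^L≤y fits)))

  increment≡⇒a≡a : ∀ L y h → q ^ L ≤ y → y %[ L ] + h < q ^ L →
    increment L (y %[ L ]) (y /[ L ]) ≡ increment L (y %[ L ] + h) (y /[ L ]) → a y ≡ a (y + h)
  increment≡⇒a≡a L y h q^L≤y fits eq =
    trans (a-block₀ L y q^L≤y) (trans (cong (addV p (a (y /[ L ]))) eq) (sym (a-block L y h q^L≤y fits)))

  module Gap (h : ℕ) (1≤h : 1 ≤ h) where

    Match : ℕ → ℕ → ℕ → Set
    Match L s c = (s + h < q ^ L) × (increment L s c ≡ increment L (s + h) c)

    match? : ∀ L s c → Dec (Match L s c)
    match? L s c = (s + h <? q ^ L) ×-dec (increment L s c ≟V increment L (s + h) c)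

    match : ℕ → ℕ → ℕ → ℕ
    match L s c = 𝟙 (match? L s c)

    fits : ℕ → ℕ → ℕ
    fits L s = 𝟙 (s + h <? q ^ L)

    Crosses : ℕ → ℕ → Set
    Crosses L s = (s + h < q ^ suc L) × ¬ (s %[ L ] + h < q ^ L)

    crosses? : ∀ L s → Dec (Crosses L s)
    crosses? L s = (s + h <? q ^ suc L) ×-dec ¬? (s %[ L ] + h <? q ^ L)

    crosses : ℕ → ℕ → ℕ
    crosses L s = 𝟙 (crosses? L s)

    private
      match-suc-inside : ∀ L s c → s < q ^ suc L → s %[ L ] + h < q ^ L →
        match (suc L) s c ≡ match L (s %[ L ]) (s /[ L ])
      match-suc-inside L s c s<qR fits₀ = 𝟙-cong (match? (suc L) s c) (match? L s₀ d)
        (λ m → fits₀ , addV-cancelˡ _ _ _ (trans (proj₂ m) shift))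
        (λ m → m<k*n⇒m%n+o<n⇒m+o<k*n R q s h s<qR fits₀ ,
               trans (cong (addV p (M (c mod q) (d mod q))) (proj₂ m)) (sym shift))
        where
        instance _ = q^≢0 L
        R = q ^ L
        d = s / R
        s₀ = s % R
        s+h≡ : s + h ≡ R * d + (s₀ + h)
        s+h≡ = trans (cong (_+ h) (m≡n*[m/n]+m%n s R)) (+-assoc (R * d) s₀ h)
        shift : increment (suc L) (s + h) c ≡ addV p (M (c mod q) (d mod q)) (increment L (s₀ + h) d)
        shift = cong₂ (λ d′ s₀′ → addV p (M (c mod q) (d′ mod q)) (increment L s₀′ d′))
                      (trans (/-congˡ s+h≡) ([n*m+o]/n≡m R d (s₀ + h) fits₀))
                      (trans (cong (_% R) s+h≡) ([n*m+o]%n≡o R d (s₀ + h) fits₀))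

      -- the two positions lie in different blocks, i.e. in different columns of M
      match-suc-crossing : ∀ L s → s < q ^ suc L → s + h < q ^ suc L → ¬ (s %[ L ] + h < q ^ L) →
        ∑ℕ[ c < q ] match (suc L) s c ≡ 1
      match-suc-crossing L s s<qR s+h<qR ¬fits₀ = begin
        ∑ℕ[ c < q ] match (suc L) s c  ≡⟨ sumℕ-cong q (λ c _ → 𝟙-cong (match? (suc L) s c) (_ ≟V _) proj₂ (s+h<qR ,_)) ⟩
        ∑ℕ[ c < q ] 𝟙 (addV p (M (c mod q) (d mod q)) X ≟V addV p (M (c mod q) (d′ mod q)) Y)
                                       ≡⟨ diffMatrix-unique-row p m p-prime M isD columns-differ X Y ⟩
        1                              ∎
        where
        open ≡-Reasoning
        instance _ = q^≢0 L
        R = q ^ L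
        d = s / R
        d′ = (s + h) / R
        X = increment L (s % R) d
        Y = increment L ((s + h) % R) d′
        d≢d′ : d ≢ d′
        d≢d′ d≡d′ = ¬fits₀ (subst (_< R) (+-cancelˡ-≡ (R * d) _ _ (begin
          R * d + (s + h) % R    ≡⟨ cong (λ e → R * e + (s + h) % R) d≡d′ ⟩
          R * d′ + (s + h) % R   ≡⟨ m≡n*[m/n]+m%n (s + h) R ⟨
          s + h                  ≡⟨ cong (_+ h) (m≡n*[m/n]+m%n s R) ⟩
          R * d + s % R + h      ≡⟨ +-assoc (R * d) (s % R) h ⟩
          R * d + (s % R + h)    ∎)) (m%n<n (s + h) R))
        columns-differ : d mod q ≢ d′ mod q
        columns-differ eq = d≢d′ (trans (sym (toℕ-mod-< (m<n*o⇒m/o<n s<qR)))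
                                        (trans (cong toℕ eq) (toℕ-mod-< (m<n*o⇒m/o<n s+h<qR))))

    sumℕ-match-suc : ∀ L s → s < q ^ suc L →
      ∑ℕ[ c < q ] match (suc L) s c ≡ q * match L (s %[ L ]) (s /[ L ]) + crosses L s
    sumℕ-match-suc L s s<qR = by-cases (s %[ L ] + h <? q ^ L) (s + h <? q ^ suc L)
      where
      open ≡-Reasoning
      s₀ = s %[ L ]
      d = s /[ L ]
      by-cases : Dec (s₀ + h < q ^ L) → Dec (s + h < q ^ suc L) →
        ∑ℕ[ c < q ] match (suc L) s c ≡ q * match L s₀ d + crosses L s
      by-cases (yes fits₀) _ = begin
        ∑ℕ[ c < q ] match (suc L) s c  ≡⟨ sumℕ-cong q (λ c _ → match-suc-inside L s c s<qR fits₀) ⟩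
        ∑ℕ[ c < q ] match L s₀ d        ≡⟨ sumℕ-const q _ ⟩
        q * match L s₀ d                ≡⟨ +-identityʳ _ ⟨
        q * match L s₀ d + 0            ≡⟨ cong (q * match L s₀ d +_) (𝟙-no (crosses? L s) (λ c → proj₂ c fits₀)) ⟨
        q * match L s₀ d + crosses L s  ∎
      by-cases (no ¬fits₀) (yes fits₁) = begin
        ∑ℕ[ c < q ] match (suc L) s c  ≡⟨ match-suc-crossing L s s<qR fits₁ ¬fits₀ ⟩
        1                               ≡⟨ cong (_+ 1) (*-zeroʳ q) ⟨
        q * 0 + 1                       ≡⟨ cong₂ (λ u v → q * u + v) (𝟙-no (match? L s₀ d) (¬fits₀ ∘ proj₁))
                                                                   (𝟙-yes (crosses? L s) (fits₁ , ¬fits₀)) ⟨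
        q * match L s₀ d + crosses L s  ∎
      by-cases (no ¬fits₀) (no ¬fits₁) = begin
        ∑ℕ[ c < q ] match (suc L) s c  ≡⟨ sumℕ-zero q (λ c _ → 𝟙-no (match? (suc L) s c) (¬fits₁ ∘ proj₁)) ⟩
        0                               ≡⟨ trans (+-identityʳ (q * 0)) (*-zeroʳ q) ⟨
        q * 0 + 0                       ≡⟨ cong₂ (λ u v → q * u + v) (𝟙-no (match? L s₀ d) (¬fits₀ ∘ proj₁))
                                                                   (𝟙-no (crosses? L s) (¬fits₁ ∘ proj₁)) ⟨
        q * match L s₀ d + crosses L s  ∎

    fits-suc : ∀ L s → s < q ^ suc L → fits L (s %[ L ]) + crosses L s ≡ fits (suc L) s
    fits-suc L s s<qR = by-cases (s %[ L ] + h <? q ^ L) (s + h <? q ^ suc L)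
      where
      instance _ = q^≢0 L
      by-cases : Dec (s %[ L ] + h < q ^ L) → Dec (s + h < q ^ suc L) → fits L (s %[ L ]) + crosses L s ≡ fits (suc L) s
      by-cases (yes fits₀) _ = trans (cong₂ _+_ (𝟙-yes (_ <? _) fits₀) (𝟙-no (crosses? L s) (λ c → proj₂ c fits₀)))
        (sym (𝟙-yes (_ <? _) (m<k*n⇒m%n+o<n⇒m+o<k*n (q ^ L) q s h s<qR fits₀)))
      by-cases (no ¬fits₀) (yes fits₁) = trans (cong₂ _+_ (𝟙-no (_ <? _) ¬fits₀) (𝟙-yes (crosses? L s) (fits₁ , ¬fits₀)))
        (sym (𝟙-yes (_ <? _) fits₁))
      by-cases (no ¬fits₀) (no ¬fits₁) = trans (cong₂ _+_ (𝟙-no (_ <? _) ¬fits₀) (𝟙-no (crosses? L s) (¬fits₁ ∘ proj₁)))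
        (sym (𝟙-no (_ <? _) ¬fits₁))

    match-density : ∀ L → ∑ℕ[ c < q ] ∑ℕ[ s < q ^ L ] match L s c ≡ ∑ℕ[ s < q ^ L ] fits L s
    match-density zero = trans (sumℕ-zero q (λ c _ → 𝟙-no (match? 0 0 c) (too-far ∘ proj₁))) (sym (𝟙-no (0 + h <? 1) too-far))
      where
      too-far : ¬ (0 + h < 1)
      too-far h<1 = <-irrefl refl (≤-trans 1≤h (s≤s⁻¹ h<1))
    match-density (suc L) = begin
      ∑ℕ[ c < q ] ∑ℕ[ s < q * R ] match (suc L) s c                      ≡⟨ sumℕ-comm q (q * R) (λ c s → match (suc L) s c) ⟩
      ∑ℕ[ s < q * R ] ∑ℕ[ c < q ] match (suc L) s c                      ≡⟨ sumℕ-cong (q * R) (λ s s< → sumℕ-match-suc L s s<) ⟩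
      ∑ℕ[ s < q * R ] (q * match L (s % R) (s / R) + crosses L s)         ≡⟨ sumℕ-distrib-+ (q * R) _ _ ⟩
      ∑ℕ[ s < q * R ] (q * match L (s % R) (s / R)) + ∑ℕ[ s < q * R ] crosses L s
                                                                          ≡⟨ cong (_+ ∑ℕ[ s < q * R ] crosses L s) lower-levels ⟩
      ∑ℕ[ s < q * R ] fits L (s % R) + ∑ℕ[ s < q * R ] crosses L s        ≡⟨ sumℕ-distrib-+ (q * R) _ _ ⟨
      ∑ℕ[ s < q * R ] (fits L (s % R) + crosses L s)                      ≡⟨ sumℕ-cong (q * R) (λ s s< → fits-suc L s s<) ⟩
      ∑ℕ[ s < q * R ] fits (suc L) s                                      ∎
      where
      open ≡-Reasoning
      instance _ = q^≢0 L
      R = q ^ L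
      lower-levels : ∑ℕ[ s < q * R ] (q * match L (s % R) (s / R)) ≡ ∑ℕ[ s < q * R ] fits L (s % R)
      lower-levels = begin
        ∑ℕ[ s < q * R ] (q * match L (s % R) (s / R))   ≡⟨ *-distribˡ-sumℕ q (q * R) _ ⟨
        q * ∑ℕ[ s < q * R ] match L (s % R) (s / R)     ≡⟨ cong (q *_) (sumℕ-divmod q R (match L)) ⟩
        q * ∑ℕ[ c < q ] ∑ℕ[ y < R ] match L y c         ≡⟨ cong (q *_) (match-density L) ⟩
        q * ∑ℕ[ y < R ] fits L y                        ≡⟨ sumℕ-const q _ ⟨
        ∑ℕ[ c < q ] ∑ℕ[ y < R ] fits L y                ≡⟨ sumℕ-divmod q R (λ y _ → fits L y) ⟨
        ∑ℕ[ s < q * R ] fits L (s % R)                  ∎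

    module Level (L : ℕ) where

      R : ℕ
      R = q ^ L

      instance
        R≢0 : NonZero R
        R≢0 = q^≢0 L
        qR≢0 : NonZero (q * R)
        qR≢0 = q^≢0 (suc L)

      blockMatch? : ∀ y → Dec (Match L (y % R) (y / R))
      blockMatch? y = match? L (y % R) (y / R)

      blockMatch : ℕ → ℕ
      blockMatch y = 𝟙 (blockMatch? y)

      blockMatch-periodic : Periodic (q * R) blockMatch
      blockMatch-periodic y = trans (same-block (y / R) (y % (q * R) / R) same-digit)
                                    (cong (λ s → match L s (y % (q * R) / R)) (sym same-offset))
        where
        same-offset : y % (q * R) % R ≡ y % R
        same-offset = m∣n⇒o%n%m≡o%m R (q * R) y (n∣m*n q)
        same-digit : y / R % q ≡ y % (q * R) / R % q
        same-digit = trans (sym (m%n%n≡m%n (y / R) q)) (cong (_% q) (sym (m%[n*o]/o≡m/o%n y q R)))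
        same-block : ∀ c c′ → c % q ≡ c′ % q → match L (y % R) c ≡ match L (y % R) c′
        same-block c c′ eq = 𝟙-cong (match? L _ c) (match? L _ c′)
          (λ x → proj₁ x , trans (sym (increment-mod L _ eq)) (trans (proj₂ x) (increment-mod L _ eq)))
          (λ x → proj₁ x , trans (increment-mod L _ eq) (trans (proj₂ x) (sym (increment-mod L _ eq))))

      blockMatch-sum : ∑ℕ[ y < q * R ] blockMatch y ≡ ∑ℕ[ s < R ] fits L s
      blockMatch-sum = trans (sumℕ-divmod q R (match L)) (match-density L)

      blockMatch-sound : ∀ y → R ≤ y → Match L (y % R) (y / R) → a y ≡ a (y + h)
      blockMatch-sound y R≤y matched = increment≡⇒a≡a L y h R≤y (proj₁ matched) (proj₂ matched)

      InBlock : ℕ → Set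
      InBlock y = y % R + h < R

      inBlock? : ∀ y → Dec (InBlock y)
      inBlock? y = y % R + h <? R

      blockMatch-complete : ∀ y → R ≤ y → InBlock y → a y ≡ a (y + h) → Match L (y % R) (y / R)
      blockMatch-complete y R≤y inBlock eq = inBlock , a≡a⇒increment≡ L y h R≤y inBlock eq

      straddles? : ∀ y → Dec (¬ InBlock y)
      straddles? y = ¬? (inBlock? y)

      straddles : ℕ → ℕ
      straddles y = 𝟙 (straddles? y)

      straddles-periodic : Periodic R straddles
      straddles-periodic y = cong (λ z → 𝟙 (¬? (z + h <? R))) (sym (m%n%n≡m%n y R))

      fits+straddles : ∑ℕ[ s < R ] fits L s + ∑ℕ[ s < R ] straddles s ≡ R
      fits+straddles = begin
        ∑ℕ[ s < R ] fits L s + ∑ℕ[ s < R ] straddles s ≡⟨ sumℕ-distrib-+ R _ _ ⟨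
        ∑ℕ[ s < R ] (fits L s + straddles s)           ≡⟨ sumℕ-cong R (λ s s<R → trans (+-comm (fits L s) (straddles s))
                                                              (subst (λ z → 𝟙 (¬? (z + h <? R)) + fits L s ≡ 1)
                                                                     (sym (m<n⇒m%n≡m s<R)) (𝟙-¬+𝟙 (s + h <? R)))) ⟩
        ∑ℕ[ s < R ] 1                                  ≡⟨ trans (sumℕ-const R 1) (*-identityʳ R) ⟩
        R                                              ∎
        where open ≡-Reasoning

      straddles-≤ : h ≤ R → ∑ℕ[ s < R ] straddles s ≤ h
      straddles-≤ h≤R = begin
        sumℕ R straddles                                      ≡⟨ cong (λ n → sumℕ n straddles) (m∸n+n≡m h≤R) ⟨
        sumℕ (R ∸ h + h) straddles                            ≡⟨ sumℕ-+ (R ∸ h) h straddles ⟩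
        sumℕ (R ∸ h) straddles + ∑ℕ[ x < h ] straddles (R ∸ h + x)
                                                              ≡⟨ cong (_+ ∑ℕ[ x < h ] straddles (R ∸ h + x)) (sumℕ-zero (R ∸ h) early) ⟩
        ∑ℕ[ x < h ] straddles (R ∸ h + x)                     ≤⟨ sumℕ-≤ h 1 (λ x _ → 𝟙≤1 _) ⟩
        h * 1                                                 ≡⟨ *-identityʳ h ⟩
        h                                                     ∎
        where
        open ≤-Reasoning
        early : ∀ s → s < R ∸ h → straddles s ≡ 0
        early s s<R-h = 𝟙-no (straddles? s) (λ ¬fits → ¬fits (subst (λ z → z + h < R) (sym (m<n⇒m%n≡m s<R))
                                                               (subst (s + h <_) (m∸n+n≡m h≤R) (+-monoˡ-< h s<R-h))))
          where
          s<R : s < R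
          s<R = <-≤-trans s<R-h (m∸n≤m R h)

      sumℕ-straddles-window : ∀ t w → ∑ℕ[ x < w * R ] straddles (t + x) ≡ w * ∑ℕ[ s < R ] straddles s
      sumℕ-straddles-window t w = begin
        ∑ℕ[ x < w * R ] straddles (t + x)                   ≡⟨ sumℕ-* w R _ ⟩
        ∑ℕ[ j < w ] ∑ℕ[ z < R ] straddles (t + (R * j + z))  ≡⟨ sumℕ-cong w (λ j _ → one-block j) ⟩
        ∑ℕ[ j < w ] sumℕ R straddles                         ≡⟨ sumℕ-const w _ ⟩
        w * sumℕ R straddles                                 ∎
        where
        open ≡-Reasoning
        one-block : ∀ j → ∑ℕ[ z < R ] straddles (t + (R * j + z)) ≡ sumℕ R straddles
        one-block j = begin
          ∑ℕ[ z < R ] straddles (t + (R * j + z))  ≡⟨ sumℕ-cong R (λ z _ → trans (straddles-periodic _)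
                                                        (trans (cong straddles (skip-block z)) (sym (straddles-periodic _)))) ⟩
          ∑ℕ[ z < R ] straddles (t + 1 * z)        ≡⟨ sumℕ-affine R 1 t (λ z R∣1z → subst (R ∣_) (+-identityʳ z) R∣1z)
                                                        straddles straddles-periodic ⟩
          sumℕ R straddles                         ∎
          where
          skip-block : ∀ z → (t + (R * j + z)) % R ≡ (t + 1 * z) % R
          skip-block z = begin
            (t + (R * j + z)) % R  ≡⟨ cong (_% R) (solve 4 (λ t R j z → t :+ (R :* j :+ z) := t :+ con 1 :* z :+ j :* R) refl t R j z) ⟩
            (t + 1 * z + j * R) % R ≡⟨ [m+kn]%n≡m%n (t + 1 * z) j R ⟩
            (t + 1 * z) % R         ∎

-- Approximate equality up to a relative error

record Close (U ε x y : ℕ) : Set where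
  constructor close
  field
    below : U * x ≤ U * y + ε
    above : U * y ≤ U * x + ε

Close-weaken : ∀ {U ε ε′ x y} → ε ≤ ε′ → Close U ε x y → Close U ε′ x y
Close-weaken ε≤ε′ (close x≲y y≲x) = close (≤-trans x≲y (+-monoʳ-≤ _ ε≤ε′)) (≤-trans y≲x (+-monoʳ-≤ _ ε≤ε′))

Close-bounded : ∀ {U b x y} → x ≤ b → y ≤ b → Close U (U * b) x y
Close-bounded {U} {b} {x} {y} x≤b y≤b = close (≤-trans (*-monoʳ-≤ U x≤b) (m≤n+m (U * b) (U * y)))
                                              (≤-trans (*-monoʳ-≤ U y≤b) (m≤n+m (U * b) (U * x)))

Close-+ : ∀ {U ε ε′ x x′ y y′} → Close U ε x y → Close U ε′ x′ y′ → Close U (ε + ε′) (x + x′) (y + y′)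
Close-+ {U} {ε} {ε′} (close x≲y y≲x) (close x′≲y′ y′≲x′) = close (add x≲y x′≲y′) (add y≲x y′≲x′)
  where
  add : ∀ {a a′ b b′} → U * a ≤ U * b + ε → U * a′ ≤ U * b′ + ε′ → U * (a + a′) ≤ U * (b + b′) + (ε + ε′)
  add {a} {a′} {b} {b′} a≲b a′≲b′ = begin
    U * (a + a′)                  ≡⟨ *-distribˡ-+ U a a′ ⟩
    U * a + U * a′                ≤⟨ +-mono-≤ a≲b a′≲b′ ⟩
    U * b + ε + (U * b′ + ε′)     ≡⟨ solve 5 (λ U b b′ ε ε′ → U :* b :+ ε :+ (U :* b′ :+ ε′) := U :* (b :+ b′) :+ (ε :+ ε′))
                                       refl U b b′ ε ε′ ⟩
    U * (b + b′) + (ε + ε′)       ∎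
    where open ≤-Reasoning

Close-sumℕ : ∀ {U ε} B {f g : ℕ → ℕ} → (∀ j → j < B → Close U ε (f j) (g j)) → Close U (B * ε) (sumℕ B f) (sumℕ B g)
Close-sumℕ zero _ = close (≤-reflexive (sym (+-identityʳ _))) (≤-reflexive (sym (+-identityʳ _)))
Close-sumℕ {U} {ε} (suc B) {f} {g} close-each = subst (λ δ → Close U δ (sumℕ (suc B) f) (sumℕ (suc B) g)) (+-comm (B * ε) ε)
  (Close-+ (Close-sumℕ B (λ j j<B → close-each j (m<n⇒m<1+n j<B))) (close-each B ≤-refl))

Close-rescale : ∀ {U V ε ε′ x y} → .{{NonZero U}} → V * ε ≤ U * ε′ → Close U ε x y → Close V ε′ x y
Close-rescale {U} {V} {ε} {ε′} Vε≤Uε′ (close x≲y y≲x) = close (rescale x≲y) (rescale y≲x)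
  where
  rescale : ∀ {a b} → U * a ≤ U * b + ε → V * a ≤ V * b + ε′
  rescale {a} {b} a≲b = *-cancelˡ-≤ U (begin
    U * (V * a)           ≡⟨ solve 3 (λ U V a → U :* (V :* a) := V :* (U :* a)) refl U V a ⟩
    V * (U * a)           ≤⟨ *-monoʳ-≤ V a≲b ⟩
    V * (U * b + ε)       ≡⟨ solve 4 (λ U V b ε → V :* (U :* b :+ ε) := U :* (V :* b) :+ V :* ε) refl U V b ε ⟩
    U * (V * b) + V * ε   ≤⟨ +-monoʳ-≤ (U * (V * b)) Vε≤Uε′ ⟩
    U * (V * b) + U * ε′  ≡⟨ *-distribˡ-+ U (V * b) ε′ ⟨
    U * (V * b + ε′)      ∎)
    where open ≤-Reasoning

Close⇒∣-∣≤ : ∀ {U ε x y} → Close U ε x y → U * ∣ x - y ∣ ≤ ε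
Close⇒∣-∣≤ {U} {ε} {x} {y} (close x≲y y≲x) with ∣m-n∣≡[m∸n]∨[n∸m] x y
... | inj₁ eq = subst (_≤ ε) (sym (trans (cong (U *_) eq) (*-distribˡ-∸ U x y))) (m≤n+o⇒m∸n≤o (U * x) (U * y) x≲y)
... | inj₂ eq = subst (_≤ ε) (sym (trans (cong (U *_) eq) (*-distribˡ-∸ U y x))) (m≤n+o⇒m∸n≤o (U * y) (U * x) y≲x)

Close-windows : ∀ (E : ℕ → ℕ) → (∀ n → E n ≤ 1) → ∀ Q .{{_ : NonZero Q}} K U D → 1 ≤ K →
  (∀ j → Close U (D * Q) Q (K * ∑ℕ[ x < Q ] E (Q + (Q * j + x)))) →
  ∀ N → Q ≤ N → Close U (D * N + U * (2 * K * Q)) N (K * sumℕ N E)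
Close-windows E E≤1 Q K U D 1≤K window N Q≤N =
  subst₂ (Close U (D * N + U * (2 * K * Q))) N≡ KC≡ (Close-weaken slack (Close-+ middle ends))
  where
  B = (N ∸ Q) / Q
  ρ = (N ∸ Q) % Q
  W : ℕ → ℕ
  W j = ∑ℕ[ x < Q ] E (Q + (Q * j + x))
  first = sumℕ Q E
  last = ∑ℕ[ x < ρ ] E (Q + (B * Q + x))
  N≡ : B * Q + (Q + ρ) ≡ N
  N≡ = begin
    B * Q + (Q + ρ)    ≡⟨ solve 3 (λ B Q ρ → B :* Q :+ (Q :+ ρ) := Q :+ (ρ :+ B :* Q)) refl B Q ρ ⟩
    Q + (ρ + B * Q)    ≡⟨ cong (Q +_) (m≡m%n+[m/n]*n (N ∸ Q) Q) ⟨
    Q + (N ∸ Q)        ≡⟨ m+[n∸m]≡n Q≤N ⟩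
    N                  ∎
    where open ≡-Reasoning
  C≡ : sumℕ N E ≡ first + (sumℕ B W + last)
  C≡ = begin
    sumℕ N E                                            ≡⟨ cong (λ n → sumℕ n E) (trans (sym N≡) (solve 3 (λ B Q ρ → B :* Q :+ (Q :+ ρ) := Q :+ (B :* Q :+ ρ)) refl B Q ρ)) ⟩
    sumℕ (Q + (B * Q + ρ)) E                            ≡⟨ sumℕ-+ Q (B * Q + ρ) E ⟩
    first + ∑ℕ[ x < B * Q + ρ ] E (Q + x)               ≡⟨ cong (first +_) (sumℕ-+ (B * Q) ρ (λ x → E (Q + x))) ⟩
    first + (∑ℕ[ x < B * Q ] E (Q + x) + last)          ≡⟨ cong (λ z → first + (z + last)) (sumℕ-* B Q (λ x → E (Q + x))) ⟩
    first + (sumℕ B W + last)                           ∎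
    where open ≡-Reasoning
  KC≡ : K * sumℕ B W + K * (first + last) ≡ K * sumℕ N E
  KC≡ = trans (solve 4 (λ K w f l → K :* w :+ K :* (f :+ l) := K :* (f :+ (w :+ l))) refl K (sumℕ B W) first last)
              (cong (K *_) (sym C≡))
  middle : Close U (B * (D * Q)) (B * Q) (K * sumℕ B W)
  middle = subst₂ (Close U (B * (D * Q))) (sumℕ-const B Q) (sym (*-distribˡ-sumℕ K B W)) (Close-sumℕ B (λ j _ → window j))
  2Q≤2KQ : Q + Q ≤ 2 * K * Q
  2Q≤2KQ = subst₂ _≤_ (solve 1 (λ Q → con 2 :* (con 1 :* Q) := Q :+ Q) refl Q) (sym (*-assoc 2 K Q)) (*-monoʳ-≤ 2 (*-monoˡ-≤ Q 1≤K))
  ends : Close U (U * (2 * K * Q)) (Q + ρ) (K * (first + last))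
  ends = Close-bounded (≤-trans (+-monoʳ-≤ Q (<⇒≤ (m%n<n (N ∸ Q) Q))) 2Q≤2KQ) (begin
    K * (first + last)   ≤⟨ *-monoʳ-≤ K (+-mono-≤ first≤Q (≤-trans last≤ρ (<⇒≤ (m%n<n (N ∸ Q) Q)))) ⟩
    K * (Q + Q)          ≡⟨ solve 2 (λ K Q → K :* (Q :+ Q) := con 2 :* K :* Q) refl K Q ⟩
    2 * K * Q            ∎)
    where
    open ≤-Reasoning
    first≤Q : first ≤ Q
    first≤Q = ≤-trans (sumℕ-≤ Q 1 (λ x _ → E≤1 x)) (≤-reflexive (*-identityʳ Q))
    last≤ρ : last ≤ ρ
    last≤ρ = ≤-trans (sumℕ-≤ ρ 1 (λ x _ → E≤1 _)) (≤-reflexive (*-identityʳ ρ))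
  slack : B * (D * Q) + U * (2 * K * Q) ≤ D * N + U * (2 * K * Q)
  slack = +-monoˡ-≤ (U * (2 * K * Q)) (begin
    B * (D * Q)   ≡⟨ solve 3 (λ B D Q → B :* (D :* Q) := D :* (B :* Q)) refl B D Q ⟩
    D * (B * Q)   ≤⟨ *-monoʳ-≤ D (≤-trans (m≤m+n (B * Q) (Q + ρ)) (≤-reflexive N≡)) ⟩
    D * N         ∎)
    where open ≤-Reasoning

-- Joint statistics of d Rudin–Shapiro sequences

module Joint (d : ℕ) (1≤d : 1 ≤ d)
    (p : Fin d → ℕ) (p-prime : ∀ i → Prime (p i)) (p-injective : ∀ i j → p i ≡ p j → i ≡ j)
    (k : Fin d → ℕ) (1≤k : ∀ i → 1 ≤ k i)
    (M : (i : Fin d) → Fin (p i ^ k i) → Fin (p i ^ k i) → ZV (p i) (k i))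
    (isD : ∀ i → IsDiffMatrix (p i) (k i) (p i ^ k i) (p i ^ k i) (p-prime i) (M i))
    (a : (i : Fin d) → ℕ → ZV (p i) (k i))
    (isRS : ∀ i → IsRudinShapiro (p i) (k i) (p-prime i) (M i) (a i))
    (e : ℕ) where

  q : Fin d → ℕ
  q i = p i ^ k i

  2≤q : ∀ i → 2 ≤ q i
  2≤q i with k i | 1≤k i
  ... | suc k′ | _ = ≤-trans (prime>1 (p-prime i)) (m≤m*n (p i) (p i ^ k′) {{m^n≢0 (p i) k′ {{prime⇒nonZero (p-prime i)}}}})

  1≤q : ∀ i → 1 ≤ q i
  1≤q i = ≤-trans (s≤s z≤n) (2≤q i)

  K : ℕ
  K = prodFin d q

  2≤K : 2 ≤ K
  2≤K = ≤-trans (2≤q i₀) (factor≤prodFin d q 1≤q i₀)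
    where i₀ = Fin.fromℕ< 1≤d

  1≤K : 1 ≤ K
  1≤K = ≤-trans (s≤s z≤n) 2≤K

  -- U is the precision: each level is chosen with U·h ≤ q^L, so straddling positions are rare
  U : ℕ
  U = 2 * suc e * K * d

  instance
    U≢0 : NonZero U
    U≢0 = >-nonZero (*-mono-≤ (*-mono-≤ {1} {2 * suc e} (s≤s z≤n) 1≤K) 1≤d)

  -- threshold · r₂ ^ d ≤ N forces 4 (e + 1) K Q ≤ N, as the period Q is at most K² (U r₂) ^ d
  threshold : ℕ
  threshold = 4 * suc e * K * K * K * U ^ d

  1≤threshold : 1 ≤ threshold
  1≤threshold = *-mono-≤ (*-mono-≤ (*-mono-≤ (*-mono-≤ {1} {4 * suc e} (s≤s z≤n) 1≤K) 1≤K) 1≤K) (m^n>0 U d)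

  module Gaps (r₁ r₂ : ℕ) (r₁<r₂ : r₁ < r₂) where

    h : ℕ
    h = r₂ ∸ r₁

    1≤h : 1 ≤ h
    1≤h = m<n⇒0<n∸m r₁<r₂

    level : ∀ i → Σ ℕ λ L → U * h ≤ q i ^ L × q i ^ L ≤ q i * (U * h)
    level i = power-between (q i) (2≤q i) (U * h) (*-mono-≤ (>-nonZero⁻¹ U) 1≤h)

    L : Fin d → ℕ
    L i = proj₁ (level i)

    module G (i : Fin d) = RudinShapiro.Gap (p i) (k i) (p-prime i) (M i) (isD i) (a i) (isRS i) h 1≤h
    module S (i : Fin d) = G.Level i (L i)

    R : Fin d → ℕ
    R = S.R

    Uh≤R : ∀ i → U * h ≤ R i
    Uh≤R i = proj₁ (proj₂ (level i))

    h≤R : ∀ i → h ≤ R i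
    h≤R i = ≤-trans (m≤n*m h U) (Uh≤R i)

    period : Fin d → ℕ
    period i = q i * R i

    Q : ℕ
    Q = prodFin d period

    instance
      Q≢0 : NonZero Q
      Q≢0 = >-nonZero (prodFin-pos d period (λ i → >-nonZero⁻¹ (period i) {{S.qR≢0 i}}))

    period-coprime : ∀ i j → i ≢ j → ∀ z → period i ∣ period j * z → period i ∣ z
    period-coprime i j i≢j z p^∣ = subst (_∣ z) (sym (as-prime-power i))
      (prime^-coprime (p-prime i) (prime∤prime^ (p-prime i) (p-prime j) (i≢j ∘ p-injective i j) (k j * suc (L j)))
        (k i * suc (L i)) z (subst₂ (λ m n → m ∣ n * z) (as-prime-power i) (as-prime-power j) p^∣))
      where
      as-prime-power : ∀ i → period i ≡ p i ^ (k i * suc (L i))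
      as-prime-power i = ^-*-assoc (p i) (k i) (suc (L i))

    fitting : Fin d → ℕ
    fitting i = ∑ℕ[ s < R i ] G.fits i (L i) s

    X : ℕ
    X = prodFin d fitting

    blockMatch-crt : ∀ t → ∑ℕ[ x < Q ] prodFin d (λ i → S.blockMatch i (t + x)) ≡ X
    blockMatch-crt t = trans (sumℕ-prodFin-crt d period (λ i → S.qR≢0 i) period-coprime S.blockMatch
                                (λ i → S.blockMatch-periodic i) t)
                             (prodFin-cong d S.blockMatch-sum)

    equal? : ∀ n → Dec (∀ i → a i (n + r₁) ≡ a i (n + r₂))
    equal? n = Fin.all? (λ i → a i (n + r₁) ≟V a i (n + r₂))

    E : ℕ → ℕ
    E n = 𝟙 (equal? n)

    shift : ∀ n → n + r₁ + h ≡ n + r₂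
    shift n = trans (+-assoc n r₁ h) (cong (n +_) (m+[n∸m]≡n (<⇒≤ r₁<r₂)))

    R≤ : ∀ n i → Q ≤ n → R i ≤ n + r₁
    R≤ n i Q≤n = ≤-trans (≤-trans (m≤n*m (R i) (q i) {{>-nonZero (1≤q i)}})
                                  (factor≤prodFin d period (λ j → >-nonZero⁻¹ (period j) {{S.qR≢0 j}}) i))
                         (≤-trans Q≤n (m≤m+n n r₁))

    matches : ℕ → ℕ
    matches y = prodFin d (λ i → S.blockMatch i y)

    E-lower : ∀ n → Q ≤ n → matches (n + r₁) ≤ E n
    E-lower n Q≤n = ≤-trans (≤-reflexive (prodFin-𝟙 d (λ i → S.blockMatch? i (n + r₁)) (Fin.all? (λ i → S.blockMatch? i (n + r₁)))))
      (𝟙-mono (Fin.all? (λ i → S.blockMatch? i (n + r₁))) (equal? n)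
        (λ matched i → trans (S.blockMatch-sound i (n + r₁) (R≤ n i Q≤n) (matched i)) (cong (a i) (shift n))))

    E-upper : ∀ n → Q ≤ n → E n ≤ matches (n + r₁) + ∑[ i < d ] S.straddles i (n + r₁)
    E-upper n Q≤n = by-cases (equal? n) (Fin.all? (λ i → S.inBlock? i (n + r₁)))
      where
      straddling = ∑[ i < d ] S.straddles i (n + r₁)
      by-cases : (D : Dec (∀ i → a i (n + r₁) ≡ a i (n + r₂))) → Dec (∀ i → S.InBlock i (n + r₁)) →
        𝟙 D ≤ matches (n + r₁) + straddling
      by-cases (no _) _ = z≤n
      by-cases (yes same) (yes inBlock) = ≤-trans (≤-reflexive (sym all-match)) (m≤m+n _ straddling)
        where
        all-match : matches (n + r₁) ≡ 1
        all-match = trans (prodFin-𝟙 d (λ i → S.blockMatch? i (n + r₁)) (Fin.all? (λ i → S.blockMatch? i (n + r₁))))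
          (𝟙-yes (Fin.all? (λ i → S.blockMatch? i (n + r₁))) (λ i → S.blockMatch-complete i (n + r₁) (R≤ n i Q≤n) (inBlock i)
                                        (trans (same i) (cong (a i) (sym (shift n))))))
      by-cases (yes _) (no ¬inBlock) with Fin.¬∀⟶∃¬ d _ (λ i → S.inBlock? i (n + r₁)) ¬inBlock
      ... | i , straddle = ≤-trans (≤-reflexive (sym (𝟙-yes (S.straddles? i (n + r₁)) straddle)))
                                   (≤-trans (∑-≥ d (λ i → S.straddles i (n + r₁)) i) (m≤n+m straddling _))

    window : ℕ → ℕ
    window j = ∑ℕ[ x < Q ] E (Q + (Q * j + x))

    offset : ℕ → ℕ
    offset j = Q + Q * j + r₁

    in-window : ∀ j x → Q + (Q * j + x) + r₁ ≡ offset j + x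
    in-window j x = solve 4 (λ Q j x r → Q :+ (Q :* j :+ x) :+ r := Q :+ Q :* j :+ r :+ x) refl Q j x r₁

    X≤window : ∀ j → X ≤ window j
    X≤window j = begin
      X                                    ≡⟨ blockMatch-crt (offset j) ⟨
      ∑ℕ[ x < Q ] matches (offset j + x)    ≤⟨ sumℕ-mono Q (λ x _ → subst (λ y → matches y ≤ E (Q + (Q * j + x))) (in-window j x)
                                                                (E-lower (Q + (Q * j + x)) (m≤m+n Q _))) ⟩
      window j                             ∎
      where open ≤-Reasoning

    straddling-per-window : ∀ t i → U * ∑ℕ[ x < Q ] S.straddles i (t + x) ≤ Q
    straddling-per-window t i with prodFin-factor d period i
    ... | w , Q≡w*period = begin
      U * ∑ℕ[ x < Q ] S.straddles i (t + x)                 ≡⟨ cong (λ n → U * ∑ℕ[ x < n ] S.straddles i (t + x)) Q≡wqR ⟩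
      U * ∑ℕ[ x < w * q i * R i ] S.straddles i (t + x)     ≡⟨ cong (U *_) (S.sumℕ-straddles-window i t (w * q i)) ⟩
      U * (w * q i * ∑ℕ[ s < R i ] S.straddles i s)         ≤⟨ *-monoʳ-≤ U (*-monoʳ-≤ (w * q i) (S.straddles-≤ i (h≤R i))) ⟩
      U * (w * q i * h)                                     ≡⟨ solve 3 (λ U w h → U :* (w :* h) := w :* (U :* h)) refl U (w * q i) h ⟩
      w * q i * (U * h)                                     ≤⟨ *-monoʳ-≤ (w * q i) (Uh≤R i) ⟩
      w * q i * R i                                         ≡⟨ Q≡wqR ⟨
      Q                                                     ∎
      where
      open ≤-Reasoning
      Q≡wqR : Q ≡ w * q i * R i
      Q≡wqR = trans Q≡w*period (sym (*-assoc w (q i) (R i)))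

    window≤ : ∀ j → U * window j ≤ U * X + d * Q
    window≤ j = begin
      U * window j                                         ≤⟨ *-monoʳ-≤ U (sumℕ-mono Q (λ x _ → subst (λ y → E (Q + (Q * j + x)) ≤ matches y + straddling y)
                                                                 (in-window j x) (E-upper (Q + (Q * j + x)) (m≤m+n Q _)))) ⟩
      U * ∑ℕ[ x < Q ] (matches (t + x) + straddling (t + x))
                                                           ≡⟨ cong (U *_) (sumℕ-distrib-+ Q _ _) ⟩
      U * (∑ℕ[ x < Q ] matches (t + x) + ∑ℕ[ x < Q ] straddling (t + x))
                                                           ≡⟨ cong (λ z → U * (z + ∑ℕ[ x < Q ] straddling (t + x))) (blockMatch-crt t) ⟩
      U * (X + ∑ℕ[ x < Q ] straddling (t + x))             ≡⟨ *-distribˡ-+ U X _ ⟩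
      U * X + U * ∑ℕ[ x < Q ] straddling (t + x)           ≡⟨ cong (λ z → U * X + U * z) (sumℕ-∑-comm Q d (λ i x → S.straddles i (t + x))) ⟩
      U * X + U * ∑[ i < d ] ∑ℕ[ x < Q ] S.straddles i (t + x)
                                                           ≡⟨ cong (U * X +_) (*-distribˡ-sum U (λ i → ∑ℕ[ x < Q ] S.straddles i (t + x))) ⟩
      U * X + ∑[ i < d ] (U * ∑ℕ[ x < Q ] S.straddles i (t + x))
                                                           ≤⟨ +-monoʳ-≤ (U * X) (∑-mono d (straddling-per-window t)) ⟩
      U * X + ∑[ i < d ] Q                                 ≡⟨ cong (U * X +_) (∑-const d Q) ⟩
      U * X + d * Q                                        ∎
      where
      open ≤-Reasoning
      t = offset j
      straddling : ℕ → ℕ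
      straddling y = ∑[ i < d ] S.straddles i y

    ∏R : ℕ
    ∏R = prodFin d R

    Q≡K*∏R : Q ≡ K * ∏R
    Q≡K*∏R = prodFin-distrib-* d q R

    fitting≤R : ∀ i → fitting i ≤ R i
    fitting≤R i = subst (fitting i ≤_) (S.fits+straddles i) (m≤m+n _ _)

    U*R≤ : ∀ i → U * R i ≤ U * fitting i + R i
    U*R≤ i = begin
      U * R i                                         ≡⟨ cong (U *_) (S.fits+straddles i) ⟨
      U * (fitting i + straddling)                    ≡⟨ *-distribˡ-+ U (fitting i) straddling ⟩
      U * fitting i + U * straddling                  ≤⟨ +-monoʳ-≤ (U * fitting i) (≤-trans (*-monoʳ-≤ U (S.straddles-≤ i (h≤R i))) (Uh≤R i)) ⟩
      U * fitting i + R i                             ∎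
      where
      open ≤-Reasoning
      straddling = ∑ℕ[ s < R i ] S.straddles i s

    UQ≤ : U * Q ≤ U * (K * X) + d * Q
    UQ≤ = begin
      U * Q                       ≡⟨ cong (U *_) Q≡K*∏R ⟩
      U * (K * ∏R)                ≡⟨ solve 3 (λ U K G → U :* (K :* G) := K :* (U :* G)) refl U K ∏R ⟩
      K * (U * ∏R)                ≤⟨ *-monoʳ-≤ K (prodFin-bernoulli d U fitting R fitting≤R U*R≤) ⟩
      K * (U * X + d * ∏R)        ≡⟨ solve 5 (λ K U X d G → K :* (U :* X :+ d :* G) := U :* (K :* X) :+ d :* (K :* G)) refl K U X d ∏R ⟩
      U * (K * X) + d * (K * ∏R)  ≡⟨ cong (λ z → U * (K * X) + d * z) Q≡K*∏R ⟨
      U * (K * X) + d * Q         ∎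
      where open ≤-Reasoning

    KX≤Q : K * X ≤ Q
    KX≤Q = subst (K * X ≤_) (sym Q≡K*∏R) (*-monoʳ-≤ K (prodFin-mono d fitting≤R))

    window-close : ∀ j → Close U (K * d * Q) Q (K * window j)
    window-close j = close below above
      where
      open ≤-Reasoning
      dQ≤KdQ : d * Q ≤ K * d * Q
      dQ≤KdQ = *-monoˡ-≤ Q (m≤n*m d K {{>-nonZero 1≤K}})
      below : U * Q ≤ U * (K * window j) + K * d * Q
      below = ≤-trans UQ≤ (+-mono-≤ (*-monoʳ-≤ U (*-monoʳ-≤ K (X≤window j))) dQ≤KdQ)
      above : U * (K * window j) ≤ U * Q + K * d * Q
      above = begin
        U * (K * window j)      ≡⟨ solve 3 (λ U K w → U :* (K :* w) := K :* (U :* w)) refl U K (window j) ⟩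
        K * (U * window j)      ≤⟨ *-monoʳ-≤ K (window≤ j) ⟩
        K * (U * X + d * Q)     ≡⟨ solve 5 (λ K U X d Q → K :* (U :* X :+ d :* Q) := U :* (K :* X) :+ K :* d :* Q) refl K U X d Q ⟩
        U * (K * X) + K * d * Q ≤⟨ +-monoˡ-≤ (K * d * Q) (*-monoʳ-≤ U KX≤Q) ⟩
        U * Q + K * d * Q       ∎

    Q≤ : Q ≤ K * K * (U ^ d * r₂ ^ d)
    Q≤ = begin
      Q                                         ≤⟨ prodFin-mono d (λ i → *-monoʳ-≤ (q i) (proj₂ (proj₂ (level i)))) ⟩
      prodFin d (λ i → q i * (q i * (U * h)))   ≡⟨ prodFin-distrib-* d q _ ⟩
      K * prodFin d (λ i → q i * (U * h))       ≡⟨ cong (K *_) (prodFin-distrib-* d q _) ⟩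
      K * (K * prodFin d (λ _ → U * h))         ≤⟨ *-monoʳ-≤ K (*-monoʳ-≤ K (prodFin-mono d (λ _ → *-monoʳ-≤ U (m∸n≤m r₂ r₁)))) ⟩
      K * (K * prodFin d (λ _ → U * r₂))        ≡⟨ cong (λ z → K * (K * z)) (trans (prodFin-distrib-* d (λ _ → U) (λ _ → r₂))
                                                                                   (cong₂ _*_ (prodFin-const d U) (prodFin-const d r₂))) ⟩
      K * (K * (U ^ d * r₂ ^ d))                ≡⟨ *-assoc K K _ ⟨
      K * K * (U ^ d * r₂ ^ d)                  ∎
      where open ≤-Reasoning

    module _ (N : ℕ) (large : threshold * r₂ ^ d ≤ N) where

      4eKQ≤N : 4 * suc e * K * Q ≤ N
      4eKQ≤N = ≤-trans (*-monoʳ-≤ (4 * suc e * K) Q≤) (≤-trans (≤-reflexive (solve 4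
        (λ e K u r → con 4 :* e :* K :* (K :* K :* (u :* r)) := con 4 :* e :* K :* K :* K :* u :* r) refl (suc e) K (U ^ d) (r₂ ^ d))) large)

      Q≤N : Q ≤ N
      Q≤N = ≤-trans (m≤n*m Q (4 * suc e * K) {{>-nonZero (*-mono-≤ {1} {4 * suc e} (s≤s z≤n) 1≤K)}}) 4eKQ≤N

      absorbed : suc e * (K * d * N + U * (2 * K * Q)) ≤ U * N
      absorbed = begin
        suc e * (K * d * N + 2 * suc e * K * d * (2 * K * Q))          ≡⟨ solve 5 (λ e K d N Q →
                                                                             e :* (K :* d :* N :+ con 2 :* e :* K :* d :* (con 2 :* K :* Q))
                                                                               := e :* (K :* d) :* N :+ e :* (K :* d) :* (con 4 :* e :* K :* Q))
                                                                             refl (suc e) K d N Q ⟩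
        suc e * (K * d) * N + suc e * (K * d) * (4 * suc e * K * Q)    ≤⟨ +-monoʳ-≤ (suc e * (K * d) * N) (*-monoʳ-≤ (suc e * (K * d)) 4eKQ≤N) ⟩
        suc e * (K * d) * N + suc e * (K * d) * N                      ≡⟨ solve 4 (λ e K d N → e :* (K :* d) :* N :+ e :* (K :* d) :* N
                                                                             := con 2 :* e :* K :* d :* N) refl (suc e) K d N ⟩
        2 * suc e * K * d * N                                          ∎
        where open ≤-Reasoning

      equal-count : Close (suc e) N N (K * sumℕ N E)
      equal-count = Close-rescale absorbed (Close-windows E (λ n → 𝟙≤1 (equal? n)) Q K U (K * d) 1≤K window-close N Q≤N)

      deltaSum+equal : deltaSum d p k a r₁ r₂ N + sumℕ N E ≡ N
      deltaSum+equal = begin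
        deltaSum d p k a r₁ r₂ N + sumℕ N E                ≡⟨ cong (_+ sumℕ N E) (countBelow≡∑𝟙 N _ (λ n → ¬? (equal? n))) ⟩
        ∑ℕ[ n < N ] 𝟙 (¬? (equal? n)) + sumℕ N E           ≡⟨ sumℕ-distrib-+ N _ E ⟨
        ∑ℕ[ n < N ] (𝟙 (¬? (equal? n)) + E n)              ≡⟨ sumℕ-cong N (λ n _ → 𝟙-¬+𝟙 (equal? n)) ⟩
        ∑ℕ[ n < N ] 1                                      ≡⟨ trans (sumℕ-const N 1) (*-identityʳ N) ⟩
        N                                                  ∎
        where open ≡-Reasoning

      deltaSum-close : suc e * ∣ ⁺ (K * deltaSum d p k a r₁ r₂ N) ℤ.- ⁺ (N * (K ∸ 1)) ∣ ≤ N * (K ∸ 1)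
      deltaSum-close = begin
        suc e * ∣ ⁺ (K * deltaSum d p k a r₁ r₂ N) ℤ.- ⁺ (N * (K ∸ 1)) ∣
                                     ≡⟨ cong (suc e *_) (∣kS-N[k-1]∣≡∣N-kC∣ K N _ _ 1≤K deltaSum+equal) ⟩
        suc e * ∣ N - K * sumℕ N E ∣ ≤⟨ Close⇒∣-∣≤ equal-count ⟩
        N                            ≤⟨ m≤m*n N (K ∸ 1) {{>-nonZero (∸-monoˡ-≤ 1 2≤K)}} ⟩
        N * (K ∸ 1)                  ∎
        where open ≤-Reasoning

corollary2 : (d : ℕ) → 2 ≤ d →
    (p : Fin d → ℕ) → (pp : (i : Fin d) → Prime (p i)) →
    ((i j : Fin d) → p i ≡ p j → i ≡ j) →
    (k : Fin d → ℕ) → ((i : Fin d) → 1 ≤ k i) →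
    (M : (i : Fin d) → Fin (p i ^ k i) → Fin (p i ^ k i) → ZV (p i) (k i)) →
    ((i : Fin d) → IsDiffMatrix (p i) (k i) (p i ^ k i) (p i ^ k i) (pp i) (M i)) →
    (a : (i : Fin d) → ℕ → ZV (p i) (k i)) →
    ((i : Fin d) → IsRudinShapiro (p i) (k i) (pp i) (M i) (a i)) →
    (r₁ r₂ : ℕ → ℕ) → ((N : ℕ) → r₁ N < r₂ N) →
    LittleORoot d r₂ →
    AsympEquivOneMinusInv (prodFin d (λ i → p i ^ k i))
      (λ N → deltaSum d p k a (r₁ N) (r₂ N) N)
corollary2 d 2≤d p p-prime p-injective k 1≤k M isD a isRS r₁ r₂ r₁<r₂ r₂-small e =
  N₀ , λ N N₀≤N → Gaps.deltaSum-close (r₁ N) (r₂ N) (r₁<r₂ N) N (large N N₀≤N)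
  where
  open Joint d (≤-trans (s≤s z≤n) 2≤d) p p-prime p-injective k 1≤k M isD a isRS e
  N₀ : ℕ
  N₀ = proj₁ (r₂-small (threshold ∸ 1))
  large : ∀ N → N₀ ≤ N → threshold * r₂ N ^ d ≤ N
  large N N₀≤N = subst (λ c → c * r₂ N ^ d ≤ N) (trans (+-comm 1 (threshold ∸ 1)) (m∸n+n≡m 1≤threshold))
                       (proj₂ (r₂-small (threshold ∸ 1)) N N₀≤N)
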